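{- Let $T$ be a finite non-abelian simple group and let $x,y\in T$ with $|x|=2$, $|y|$ an odd prime and $T=\langle x,y\rangle$. Let $X=T\wr \mathrm{S}_6=T^6{:}\mathrm{S}_6$, where $\sigma\in\mathrm{S}_6$ acts on $T^6$ by $(t_1,\dots,t_6)^\sigma=(t_{1^{\sigma^{ -1}}},\dots,t_{6^{\sigma^{ -1}}})$. In $\mathrm{S}_6$ let $h_1=(146)(235)$, $h_2=(13)(24)(56)$, $\delta=(14)(23)(56)$, and let $H=\langle h_1,h_2\rangle$. Let $f=(y,y^{ -1},y,y^{ -1},x,x)\in T^6$, $g=f\delta\in X$, $Y=\langle H,g\rangle$, and $\Gamma=\mathrm{Cos}(Y,H,HgH)$. Then $\Gamma$ is a connected $(Y,2)$-arc-transitive graph, $Y\cong T^d.\mathrm{S}_4$ (i.e. $Y$ has a normal subgroup $M\cong T^d$ with $Y/M\cong\mathrm{S}_4$), and $\Gamma$ is an $M$-cover of $\mathrm{K}_4$, where $d\in\{1,3,6\}$.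
   Context: For a group $G$, a subgroup $H$ and $g\in G$, the coset graph $\mathrm{Cos}(G,H,HgH)$ has vertex set the set of right cosets $\{Hz: z\in G\}$, with $(Hz,Hw)$ an arc iff $wz^{ -1}\in HgH$; $G$ acts on it by right multiplication. An $s$-arc is a sequence of $s+1$ vertices, consecutive ones adjacent and any three consecutive distinct; $\Gamma$ is $(G,2)$-arc-transitive if $G\leq\mathrm{Aut}(\Gamma)$ (here acting possibly unfaithfully via the coset action) is transitive on $2$-arcs. For $N\trianglelefteq G$, the normal quotient $\Gamma_N$ has as vertices the $N$-orbits, two adjacent iff they contain adjacent vertices of $\Gamma$; $\Gamma$ is an $N$-cover of $\Gamma_N$ if $N$ has at least $3$ orbits and $\Gamma$, $\Gamma_N$ have the same valency. $\mathrm{K}_4$ is the complete graph on $4$ vertices. -}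

module Defs where

open import Level using (0ℓ)
open import Algebra.Bundles using (Group)
open import Algebra.Morphism.Structures using (module GroupMorphisms)
import Algebra.Properties.Group as GP
open import Data.Nat using (ℕ; zero; suc; _<_)
open import Data.Fin using (Fin)
open import Data.Fin.Patterns using (0F; 1F; 2F; 3F; 4F; 5F)
open import Data.Fin.Permutation as P using (Permutation′; _⟨$⟩ʳ_; _⟨$⟩ˡ_; _∘ₚ_; permutation)
import Data.List as List
open import Data.List using (List)
open import Data.List.Membership.Propositional using (_∈_)
open import Data.Product using (Σ; ∃; ∃₂; _×_; _,_; proj₁; proj₂)
open import Data.Sum using (_⊎_)
open import Data.Empty using (⊥)
open import Relation.Nullary using (¬_)
open import Relation.Binary.PropositionalEquality as Eq using (_≡_; _≢_; refl)
import Relation.Binary.Reasoning.Setoid as SetoidR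

module _ (G : Group 0ℓ 0ℓ) where
  open Group G

  pow : Carrier → ℕ → Carrier
  pow x zero    = ε
  pow x (suc n) = x ∙ pow x n

  HasOrder : Carrier → ℕ → Set
  HasOrder x n = (0 < n) × (pow x n ≈ ε) × (∀ m → 0 < m → m < n → ¬ (pow x m ≈ ε))

  record IsSubgroup (P : Carrier → Set) : Set where
    field
      resp  : ∀ {a b} → a ≈ b → P a → P b
      ε∈    : P ε
      ∙∈    : ∀ {a b} → P a → P b → P (a ∙ b)
      ⁻¹∈   : ∀ {a} → P a → P (a ⁻¹)

  record IsNormalSubgroup (N : Carrier → Set) : Set where
    field
      isSubgroup : IsSubgroup N
      conj       : ∀ g {n} → N n → N (g ∙ n ∙ g ⁻¹)
    open IsSubgroup isSubgroup public

  IsFinite : Set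
  IsFinite = Σ ℕ λ n → Σ (Fin n → Carrier) λ e → ∀ a → ∃ λ i → e i ≈ a

  IsNonAbelian : Set
  IsNonAbelian = ∃₂ λ a b → ¬ (a ∙ b ≈ b ∙ a)

  IsSimple : Set₁
  IsSimple = (∃ λ a → ¬ (a ≈ ε))
           × (∀ (N : Carrier → Set) → IsNormalSubgroup N →
                (∀ a → N a → a ≈ ε) ⊎ (∀ a → N a))

  data ⟨_⟩ (gens : List Carrier) : Carrier → Set where
    gen  : ∀ {a} → a ∈ gens → ⟨ gens ⟩ a
    one  : ⟨ gens ⟩ ε
    mul  : ∀ {a b} → ⟨ gens ⟩ a → ⟨ gens ⟩ b → ⟨ gens ⟩ (a ∙ b)
    inv  : ∀ {a} → ⟨ gens ⟩ a → ⟨ gens ⟩ (a ⁻¹)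
    resp : ∀ {a b} → a ≈ b → ⟨ gens ⟩ a → ⟨ gens ⟩ b

  ⟨⟩-isSubgroup : ∀ gens → IsSubgroup ⟨ gens ⟩
  ⟨⟩-isSubgroup gens = record { resp = resp ; ε∈ = one ; ∙∈ = mul ; ⁻¹∈ = inv }

  subgroupGroup : (P : Carrier → Set) → IsSubgroup P → Group 0ℓ 0ℓ
  subgroupGroup P sp = record
    { Carrier = Σ Carrier P
    ; _≈_ = λ a b → proj₁ a ≈ proj₁ b
    ; _∙_ = λ a b → (proj₁ a ∙ proj₁ b , S.∙∈ (proj₂ a) (proj₂ b))
    ; ε = (ε , S.ε∈)
    ; _⁻¹ = λ a → (proj₁ a ⁻¹ , S.⁻¹∈ (proj₂ a))
    ; isGroup = record
      { isMonoid = record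
        { isSemigroup = record
          { isMagma = record
            { isEquivalence = record { refl = refl′ ; sym = sym ; trans = trans }
            ; ∙-cong = ∙-cong }
          ; assoc = λ a b c → assoc (proj₁ a) (proj₁ b) (proj₁ c) }
        ; identity = (λ a → identityˡ (proj₁ a)) , (λ a → identityʳ (proj₁ a)) }
      ; inverse = (λ a → inverseˡ (proj₁ a)) , (λ a → inverseʳ (proj₁ a))
      ; ⁻¹-cong = ⁻¹-cong }
    }
    where
      module S = IsSubgroup sp
      refl′ : ∀ {a} → a ≈ a
      refl′ = Group.refl G

  -- the quotient group G/N (cosets represented by elements, Nx = Ny iff x y⁻¹ ∈ N)
  quotientGroup : (N : Carrier → Set) → IsNormalSubgroup N → Group 0ℓ 0ℓ
  quotientGroup N nN = record
    { Carrier = Carrier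
    ; _≈_ = _∼_
    ; _∙_ = _∙_
    ; ε = ε
    ; _⁻¹ = _⁻¹
    ; isGroup = record
      { isMonoid = record
        { isSemigroup = record
          { isMagma = record
            { isEquivalence = record { refl = fromEq (Group.refl G) ; sym = sym∼ ; trans = trans∼ }
            ; ∙-cong = cong∼ }
          ; assoc = λ a b c → fromEq (assoc a b c) }
        ; identity = (λ a → fromEq (identityˡ a)) , (λ a → fromEq (identityʳ a)) }
      ; inverse = (λ a → fromEq (inverseˡ a)) , (λ a → fromEq (inverseʳ a))
      ; ⁻¹-cong = inv∼ }
    }
    where
      module N = IsNormalSubgroup nN
      open GP G using (⁻¹-anti-homo-∙; ⁻¹-involutive)
      open SetoidR setoid
      _∼_ : Carrier → Carrier → Set
      x ∼ y = N (x ∙ y ⁻¹)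
      fromEq : ∀ {x y} → x ≈ y → x ∼ y
      fromEq {x} {y} eq = N.resp (sym (trans (∙-congʳ eq) (inverseʳ y))) N.ε∈
      sym∼ : ∀ {x y} → x ∼ y → y ∼ x
      sym∼ {x} {y} p = N.resp (trans (⁻¹-anti-homo-∙ x (y ⁻¹)) (∙-congʳ (⁻¹-involutive y))) (N.⁻¹∈ p)
      trans∼ : ∀ {x y z} → x ∼ y → y ∼ z → x ∼ z
      trans∼ {x} {y} {z} p q = N.resp eq (N.∙∈ p q)
        where
          eq : (x ∙ y ⁻¹) ∙ (y ∙ z ⁻¹) ≈ x ∙ z ⁻¹
          eq = begin
            (x ∙ y ⁻¹) ∙ (y ∙ z ⁻¹) ≈⟨ assoc x (y ⁻¹) (y ∙ z ⁻¹) ⟩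
            x ∙ (y ⁻¹ ∙ (y ∙ z ⁻¹)) ≈⟨ ∙-congˡ (sym (assoc (y ⁻¹) y (z ⁻¹))) ⟩
            x ∙ ((y ⁻¹ ∙ y) ∙ z ⁻¹) ≈⟨ ∙-congˡ (∙-congʳ (inverseˡ y)) ⟩
            x ∙ (ε ∙ z ⁻¹)          ≈⟨ ∙-congˡ (identityˡ (z ⁻¹)) ⟩
            x ∙ z ⁻¹ ∎
      cong∼ : ∀ {x x′ y y′} → x ∼ x′ → y ∼ y′ → (x ∙ y) ∼ (x′ ∙ y′)
      cong∼ {x} {x′} {y} {y′} p q = N.resp eq (N.∙∈ (N.conj x q) p)
        where
          eq : (x ∙ (y ∙ y′ ⁻¹) ∙ x ⁻¹) ∙ (x ∙ x′ ⁻¹) ≈ (x ∙ y) ∙ (x′ ∙ y′) ⁻¹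
          eq = begin
            (x ∙ (y ∙ y′ ⁻¹) ∙ x ⁻¹) ∙ (x ∙ x′ ⁻¹) ≈⟨ assoc (x ∙ (y ∙ y′ ⁻¹)) (x ⁻¹) (x ∙ x′ ⁻¹) ⟩
            (x ∙ (y ∙ y′ ⁻¹)) ∙ (x ⁻¹ ∙ (x ∙ x′ ⁻¹)) ≈⟨ ∙-congˡ (sym (assoc (x ⁻¹) x (x′ ⁻¹))) ⟩
            (x ∙ (y ∙ y′ ⁻¹)) ∙ ((x ⁻¹ ∙ x) ∙ x′ ⁻¹) ≈⟨ ∙-congˡ (∙-congʳ (inverseˡ x)) ⟩
            (x ∙ (y ∙ y′ ⁻¹)) ∙ (ε ∙ x′ ⁻¹) ≈⟨ ∙-congˡ (identityˡ (x′ ⁻¹)) ⟩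
            (x ∙ (y ∙ y′ ⁻¹)) ∙ x′ ⁻¹ ≈⟨ ∙-congʳ (sym (assoc x y (y′ ⁻¹))) ⟩
            ((x ∙ y) ∙ y′ ⁻¹) ∙ x′ ⁻¹ ≈⟨ assoc (x ∙ y) (y′ ⁻¹) (x′ ⁻¹) ⟩
            (x ∙ y) ∙ (y′ ⁻¹ ∙ x′ ⁻¹) ≈⟨ ∙-congˡ (sym (⁻¹-anti-homo-∙ x′ y′)) ⟩
            (x ∙ y) ∙ (x′ ∙ y′) ⁻¹ ∎
      inv∼ : ∀ {x y} → x ∼ y → (x ⁻¹) ∼ (y ⁻¹)
      inv∼ {x} {y} p = N.resp eq (N.conj (x ⁻¹) (sym∼ p))
        where
          eq : x ⁻¹ ∙ (y ∙ x ⁻¹) ∙ x ⁻¹ ⁻¹ ≈ x ⁻¹ ∙ y ⁻¹ ⁻¹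
          eq = begin
            x ⁻¹ ∙ (y ∙ x ⁻¹) ∙ x ⁻¹ ⁻¹ ≈⟨ ∙-congˡ (⁻¹-involutive x) ⟩
            x ⁻¹ ∙ (y ∙ x ⁻¹) ∙ x       ≈⟨ assoc (x ⁻¹) (y ∙ x ⁻¹) x ⟩
            x ⁻¹ ∙ ((y ∙ x ⁻¹) ∙ x)     ≈⟨ ∙-congˡ (assoc y (x ⁻¹) x) ⟩
            x ⁻¹ ∙ (y ∙ (x ⁻¹ ∙ x))     ≈⟨ ∙-congˡ (∙-congˡ (inverseˡ x)) ⟩
            x ⁻¹ ∙ (y ∙ ε)              ≈⟨ ∙-congˡ (identityʳ y) ⟩
            x ⁻¹ ∙ y                    ≈⟨ ∙-congˡ (sym (⁻¹-involutive y)) ⟩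
            x ⁻¹ ∙ y ⁻¹ ⁻¹ ∎

_≅_ : Group 0ℓ 0ℓ → Group 0ℓ 0ℓ → Set
G ≅ H = Σ (Group.Carrier G → Group.Carrier H)
          (GroupMorphisms.IsGroupIsomorphism (Group.rawGroup G) (Group.rawGroup H))

-- Symmetric group Sym(n), acting on the right: i^σ = σ ⟨$⟩ʳ i,
-- product σ τ = "first σ, then τ" (stdlib _∘ₚ_)

Sym : ℕ → Group 0ℓ 0ℓ
Sym n = record
  { Carrier = Permutation′ n
  ; _≈_ = P._≈_
  ; _∙_ = _∘ₚ_
  ; ε = P.id
  ; _⁻¹ = P.flip
  ; isGroup = record
    { isMonoid = record
      { isSemigroup = record
        { isMagma = record
          { isEquivalence = record
            { refl = λ _ → refl ; sym = λ p i → Eq.sym (p i) ; trans = λ p q i → Eq.trans (p i) (q i) }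
          ; ∙-cong = λ {π} {π′} {ρ} {ρ′} p q i → Eq.trans (Eq.cong (ρ ⟨$⟩ʳ_) (p i)) (q (π′ ⟨$⟩ʳ i)) }
        ; assoc = λ _ _ _ _ → refl }
      ; identity = (λ _ _ → refl) , (λ _ _ → refl) }
    ; inverse = (λ π i → P.inverseʳ π) , (λ π i → P.inverseˡ π)
    ; ⁻¹-cong = λ {π} {ρ} → inv-cong {π} {ρ} }
  }
  where
    inv-cong : ∀ {π ρ : Permutation′ n} → π P.≈ ρ → P.flip π P.≈ P.flip ρ
    inv-cong {π} {ρ} p j = Eq.trans (Eq.sym (P.inverseˡ ρ))
      (Eq.cong (ρ ⟨$⟩ˡ_) (Eq.trans (Eq.sym (p (π ⟨$⟩ˡ j))) (P.inverseʳ π)))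

-- An element (f , σ) stands for f σ with f ∈ T^n, σ ∈ Sym(n); σ acts on T^n by
-- (t₁,…,tₙ)^σ = (t_{1^{σ⁻¹}},…,t_{n^{σ⁻¹}}), so
-- (f , σ)(f′ , σ′) = (f · f′^{σ⁻¹} , σ σ′), i.e. component i is f i · f′ (i^σ).

Wreath : Group 0ℓ 0ℓ → ℕ → Group 0ℓ 0ℓ
Wreath T n = record
  { Carrier = (Fin n → Carrier) × Permutation′ n
  ; _≈_ = λ a b → (∀ i → proj₁ a i ≈ proj₁ b i) × (proj₂ a P.≈ proj₂ b)
  ; _∙_ = λ a b → ((λ i → proj₁ a i ∙ proj₁ b (proj₂ a ⟨$⟩ʳ i)) , (proj₂ a ∘ₚ proj₂ b))
  ; ε = ((λ _ → ε) , P.id)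
  ; _⁻¹ = λ a → ((λ j → proj₁ a (proj₂ a ⟨$⟩ˡ j) ⁻¹) , P.flip (proj₂ a))
  ; isGroup = record
    { isMonoid = record
      { isSemigroup = record
        { isMagma = record
          { isEquivalence = record
            { refl = (λ _ → Group.refl T) , (λ _ → refl)
            ; sym = λ p → (λ i → sym (proj₁ p i)) , (λ i → Eq.sym (proj₂ p i))
            ; trans = λ p q → (λ i → trans (proj₁ p i) (proj₁ q i)) , (λ i → Eq.trans (proj₂ p i) (proj₂ q i)) }
          ; ∙-cong = λ {a} {a′} {b} {b′} p q →
              (λ i → ∙-cong (proj₁ p i) (trans (proj₁ q (proj₂ a ⟨$⟩ʳ i)) (reflexive (Eq.cong (proj₁ b′) (proj₂ p i)))))
              , Group.∙-cong (Sym n) {proj₂ a} {proj₂ a′} {proj₂ b} {proj₂ b′} (proj₂ p) (proj₂ q) }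
        ; assoc = λ a b c → (λ i → assoc _ _ _) , (λ _ → refl) }
      ; identity = (λ a → (λ i → identityˡ _) , (λ _ → refl)) , (λ a → (λ i → identityʳ _) , (λ _ → refl)) }
    ; inverse = (λ a → (λ i → inverseˡ _) , (λ i → P.inverseʳ (proj₂ a)))
              , (λ a → (λ i → trans (∙-congˡ (⁻¹-cong (reflexive (Eq.cong (proj₁ a) (P.inverseˡ (proj₂ a)))))) (inverseʳ _))
                     , (λ i → P.inverseˡ (proj₂ a)))
    ; ⁻¹-cong = λ {a} {b} p →
        (λ j → ⁻¹-cong (trans (proj₁ p _) (reflexive (Eq.cong (proj₁ b)
                  (Group.⁻¹-cong (Sym n) {proj₂ a} {proj₂ b} (proj₂ p) j)))))
        , Group.⁻¹-cong (Sym n) {proj₂ a} {proj₂ b} (proj₂ p) }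
  }
  where open Group T hiding (refl)

record Graph : Set₁ where
  field
    V    : Set
    _≃_  : V → V → Set
    Adj  : V → V → Set

module _ (Γ : Graph) where
  open Graph Γ

  IsUndirected : Set
  IsUndirected = (∀ u v → Adj u v → Adj v u) × (∀ v → ¬ Adj v v)

  data Walk : V → V → Set where
    stop : ∀ {u v} → u ≃ v → Walk u v
    step : ∀ {u w v} → Adj u w → Walk w v → Walk u v

  Connected : Set
  Connected = ∀ u v → Walk u v

  Is2Arc : V → V → V → Set
  Is2Arc v₀ v₁ v₂ = Adj v₀ v₁ × Adj v₁ v₂ × ¬ (v₀ ≃ v₂)

  TwoArcTransitive : {A : Set} → (V → A → V) → Set
  TwoArcTransitive {A} act = ∀ u₀ u₁ u₂ v₀ v₁ v₂ → Is2Arc u₀ u₁ u₂ → Is2Arc v₀ v₁ v₂ →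
    ∃ λ (a : A) → (act u₀ a ≃ v₀) × (act u₁ a ≃ v₁) × (act u₂ a ≃ v₂)

  HasValency : ℕ → Set
  HasValency k = ∀ v → Σ (Fin k → V) λ nb →
      (∀ i → Adj v (nb i)) × (∀ i j → nb i ≃ nb j → i ≡ j) × (∀ w → Adj v w → ∃ λ i → w ≃ nb i)

  AtLeast3Vertices : Set
  AtLeast3Vertices = Σ V λ a → Σ V λ b → Σ V λ c → ¬ (a ≃ b) × ¬ (a ≃ c) × ¬ (b ≃ c)

  normalQuotient : {A : Set} → (V → A → V) → (A → Set) → Graph
  normalQuotient {A} act N = record
    { V = V
    ; _≃_ = _∼_
    ; Adj = λ u v → ∃₂ λ u′ v′ → (u ∼ u′) × (v ∼ v′) × Adj u′ v′ }
    where
      _∼_ : V → V → Set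
      u ∼ v = ∃ λ n → N n × (act u n ≃ v)


IsNCover : (Γ : Graph) {A : Set} → (Graph.V Γ → A → Graph.V Γ) → (A → Set) → Set
IsNCover Γ act N = AtLeast3Vertices (normalQuotient Γ act N)
  × ∃ λ k → HasValency Γ k × HasValency (normalQuotient Γ act N) k

_≅ᴳ_ : Graph → Graph → Set
Γ ≅ᴳ Δ = Σ (Γ.V → Δ.V) λ φ →
    (∀ u v → u Γ.≃ v → φ u Δ.≃ φ v)
  × (∀ u v → φ u Δ.≃ φ v → u Γ.≃ v)
  × (∀ w → ∃ λ u → φ u Δ.≃ w)
  × (∀ u v → (Γ.Adj u v → Δ.Adj (φ u) (φ v)) × (Δ.Adj (φ u) (φ v) → Γ.Adj u v))
  where
    module Γ = Graph Γ
    module Δ = Graph Δ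

K4 : Graph
K4 = record { V = Fin 4 ; _≃_ = _≡_ ; Adj = _≢_ }

-- coset graph Cos(G, H, HgH): vertices are right cosets Hz (represented by z,
-- with Hz = Hw iff w z⁻¹ ∈ H); Hz → Hw is an arc iff w z⁻¹ ∈ HgH
CosetGraph : (G : Group 0ℓ 0ℓ) → (Group.Carrier G → Set) → Group.Carrier G → Graph
CosetGraph G H g = record
  { V = Carrier
  ; _≃_ = λ z w → H (w ∙ z ⁻¹)
  ; Adj = λ z w → ∃₂ λ h h′ → H h × H h′ × (w ∙ z ⁻¹ ≈ h ∙ g ∙ h′) }
  where open Group G

-- The specific data of the corollary (points 1..6 are 0F..5F)

module Construction (T : Group 0ℓ 0ℓ) (x y : Group.Carrier T) where
  open Group T using (ε; _⁻¹)

  S6 : Group 0ℓ 0ℓ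
  S6 = Sym 6

  X : Group 0ℓ 0ℓ
  X = Wreath T 6

  h₁-fun h₁-inv : Fin 6 → Fin 6
  h₁-fun 0F = 3F
  h₁-fun 3F = 5F
  h₁-fun 5F = 0F
  h₁-fun 1F = 2F
  h₁-fun 2F = 4F
  h₁-fun 4F = 1F
  h₁-inv 3F = 0F
  h₁-inv 5F = 3F
  h₁-inv 0F = 5F
  h₁-inv 2F = 1F
  h₁-inv 4F = 2F
  h₁-inv 1F = 4F

  h₁ : Permutation′ 6
  h₁ = permutation h₁-fun h₁-inv l r
    where
      l : ∀ i → h₁-fun (h₁-inv i) ≡ i
      l 0F = refl
      l 1F = refl
      l 2F = refl
      l 3F = refl
      l 4F = refl
      l 5F = refl
      r : ∀ i → h₁-inv (h₁-fun i) ≡ i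
      r 0F = refl
      r 1F = refl
      r 2F = refl
      r 3F = refl
      r 4F = refl
      r 5F = refl

  h₂-fun : Fin 6 → Fin 6
  h₂-fun 0F = 2F
  h₂-fun 2F = 0F
  h₂-fun 1F = 3F
  h₂-fun 3F = 1F
  h₂-fun 4F = 5F
  h₂-fun 5F = 4F

  h₂-invol : ∀ i → h₂-fun (h₂-fun i) ≡ i
  h₂-invol 0F = refl
  h₂-invol 1F = refl
  h₂-invol 2F = refl
  h₂-invol 3F = refl
  h₂-invol 4F = refl
  h₂-invol 5F = refl

  h₂ : Permutation′ 6
  h₂ = permutation h₂-fun h₂-fun h₂-invol h₂-invol

  δ-fun : Fin 6 → Fin 6
  δ-fun 0F = 3F
  δ-fun 3F = 0F
  δ-fun 1F = 2F
  δ-fun 2F = 1F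
  δ-fun 4F = 5F
  δ-fun 5F = 4F

  δ-invol : ∀ i → δ-fun (δ-fun i) ≡ i
  δ-invol 0F = refl
  δ-invol 1F = refl
  δ-invol 2F = refl
  δ-invol 3F = refl
  δ-invol 4F = refl
  δ-invol 5F = refl

  δ : Permutation′ 6
  δ = permutation δ-fun δ-fun δ-invol δ-invol

  perm : Permutation′ 6 → Group.Carrier X
  perm σ = ((λ _ → ε) , σ)

  f : Fin 6 → Group.Carrier T
  f 0F = y
  f 1F = y ⁻¹
  f 2F = y
  f 3F = y ⁻¹
  f 4F = x
  f 5F = x

  g : Group.Carrier X
  g = (f , δ)

  Hₓ : Group.Carrier X → Set
  Hₓ = ⟨ X ⟩ (perm h₁ List.∷ perm h₂ List.∷ List.[])

  Yₓ : Group.Carrier X → Set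
  Yₓ = ⟨ X ⟩ (perm h₁ List.∷ perm h₂ List.∷ g List.∷ List.[])

  Y : Group 0ℓ 0ℓ
  Y = subgroupGroup X Yₓ (⟨⟩-isSubgroup X _)

  H : Group.Carrier Y → Set
  H z = Hₓ (proj₁ z)

  gᵧ : Group.Carrier Y
  gᵧ = (g , gen (there (there (here refl))))
    where open import Data.List.Relation.Unary.Any using (here; there)

  Γ : Graph
  Γ = CosetGraph Y H gᵧ

  act : Group.Carrier Y → Group.Carrier Y → Group.Carrier Y
  act = Group._∙_ Y

{-# OPTIONS --safe #-}
module Submission where

-- The permutation parts of h₁, h₂, δ generate a group K ≤ S₆ of order 24: every element is
-- h₂ᵗ h₁ᶜ r for a unique t < 2, c < 3 and r ∈ {1, δh₁, δh₁², δ}, and these 24 normal forms are closed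
-- under multiplication by the generators, which is checked by computation. The action of K on the
-- four right cosets of π(H) = ⟨h₁, h₂⟩ ≅ S₃ is an isomorphism ψ : K ≅ S₄, so M = Y ∩ T⁶ = ker (ψ ∘ π)
-- and Y/M ≅ S₄. The M-orbits on vertices Hz are then labelled by the coset ψ(z)(0), which turns Γ_M
-- into K₄. Since g is an involution commuting with h₂ and H = ⟨h₂⟩⟨h₁⟩, the neighbours of Hv are the
-- Hgh₁ᶜv, and h₂ fixes the arc (H, Hg) while swapping the two 2-arcs continuing it: Γ is
-- (Y,2)-arc-transitive. Finally M, as a subgroup of T⁶, projects onto each coordinate (the first
-- coordinate contains xy⁻² and y⁻⁴, hence x and y since |y| is odd), and K permutes the coordinates
-- preserving the blocks {0,1}, {2,3}, {4,5}, transitively on points and on pairs from different blocks.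
-- Simplicity of T makes each pair of coordinates either dependent or independent, and commutators
-- show that independent coordinates can be prescribed separately; so M ≅ T, T³ or T⁶.

open import Level using (0ℓ)
open import Algebra.Bundles using (Group)
open import Algebra.Construct.Pointwise using (group)
open import Data.Nat using (ℕ; zero; suc; _+_; _*_; s≤s; z≤n; nonTrivial⇒n>1)
import Data.Nat.Properties as ℕₚ
open import Data.Nat.Divisibility using (_∣_; divides)
open import Data.Nat.Primality using (Prime; prime⇒nonTrivial)
open import Data.Fin using (Fin; zero; suc; toℕ; inject₁; lower₁)
open import Data.Fin.Patterns using (0F; 1F; 2F; 3F; 4F; 5F)
open import Data.Fin.Properties using (_≟_; all?; any?; inject₁-lower₁; toℕ-injective; suc-injective)
open import Data.Fin.Permutation as Perm using (Permutation′; _⟨$⟩ʳ_; _⟨$⟩ˡ_; _∘ₚ_; transpose)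
open import Data.List using (List; _∷_; []; _++_; replicate; filter; allFin)
open import Data.List.Properties using (++-identityʳ)
open import Data.List.Membership.Propositional using (_∈_)
open import Data.List.Membership.Propositional.Properties using (∈-filter⁺; ∈-allFin)
open import Data.List.Relation.Unary.Any using (here; there)
open import Data.List.Relation.Unary.All as All using (All; []; _∷_)
open import Data.List.Relation.Unary.All.Properties using (all-filter)
open import Data.Vec using (Vec; []; _∷_; lookup)
open import Data.Vec.N-ary using (N-ary; Eq; curryⁿ; curryⁿ-cong)
open import Data.Product using (Σ; ∃; ∃₂; _×_; _,_; proj₁; proj₂)
open import Data.Product.Properties using (≡-dec)
open import Data.Sum using (_⊎_; inj₁; inj₂)
open import Data.Empty using (⊥-elim)
open import Data.Unit using (tt)
open import Function using (_∘_)
open import Relation.Nullary using (¬_; Dec; yes; no)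
open import Relation.Nullary.Decidable using (toWitness; _×-dec_; _→-dec_; ¬?; map′)
open import Relation.Unary using (Decidable)
open import Relation.Binary.PropositionalEquality as ≡ using (_≡_; _≢_)
open import Defs

module GroupSolver {c ℓ} (G : Group c ℓ) where

  open Group G
  open import Algebra.Properties.Group G using (⁻¹-involutive; ⁻¹-anti-homo-∙; ε⁻¹≈ε)
  open import Relation.Binary.Reasoning.Setoid setoid

  infixl 7 _⊕_
  infix 8 ⊝_

  data Expr (n : ℕ) : Set where
    var : Fin n → Expr n
    id  : Expr n
    _⊕_ : Expr n → Expr n → Expr n
    ⊝_  : Expr n → Expr n

  data Literal (n : ℕ) : Set where
    _⁺ _⁻ : Fin n → Literal n

  FreeWord : ℕ → Set
  FreeWord n = List (Literal n)

  private variable n : ℕ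

  invertLiteral : Literal n → Literal n
  invertLiteral (i ⁺) = i ⁻
  invertLiteral (i ⁻) = i ⁺

  _◁_ : Literal n → FreeWord n → FreeWord n
  ℓ ◁ [] = ℓ ∷ []
  (i ⁺) ◁ (j ⁺ ∷ w) = i ⁺ ∷ j ⁺ ∷ w
  (i ⁻) ◁ (j ⁻ ∷ w) = i ⁻ ∷ j ⁻ ∷ w
  (i ⁺) ◁ (j ⁻ ∷ w) with i ≟ j
  ... | yes _ = w
  ... | no _  = i ⁺ ∷ j ⁻ ∷ w
  (i ⁻) ◁ (j ⁺ ∷ w) with i ≟ j
  ... | yes _ = w
  ... | no _  = i ⁻ ∷ j ⁺ ∷ w

  _·_ : FreeWord n → FreeWord n → FreeWord n
  [] · v      = v
  (ℓ ∷ u) · v = ℓ ◁ (u · v)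

  invertFreeWord : FreeWord n → FreeWord n
  invertFreeWord []      = []
  invertFreeWord (ℓ ∷ w) = invertFreeWord w · (invertLiteral ℓ ∷ [])

  normalise : Expr n → FreeWord n
  normalise (var i) = i ⁺ ∷ []
  normalise id      = []
  normalise (a ⊕ b) = normalise a · normalise b
  normalise (⊝ a)   = invertFreeWord (normalise a)

  ⟦_⟧ : Expr n → Vec Carrier n → Carrier
  ⟦ var i ⟧ ρ = lookup ρ i
  ⟦ id ⟧    ρ = ε
  ⟦ a ⊕ b ⟧ ρ = ⟦ a ⟧ ρ ∙ ⟦ b ⟧ ρ
  ⟦ ⊝ a ⟧   ρ = ⟦ a ⟧ ρ ⁻¹

  module _ (ρ : Vec Carrier n) where

    ⟦_⟧ˡ : Literal n → Carrier
    ⟦ i ⁺ ⟧ˡ = lookup ρ i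
    ⟦ i ⁻ ⟧ˡ = lookup ρ i ⁻¹

    ⟦_⟧ʷ : FreeWord n → Carrier
    ⟦ [] ⟧ʷ    = ε
    ⟦ ℓ ∷ w ⟧ʷ = ⟦ ℓ ⟧ˡ ∙ ⟦ w ⟧ʷ

    private
      cancel : ∀ {a b} c → a ∙ b ≈ ε → c ≈ a ∙ (b ∙ c)
      cancel {a} {b} c ab≈ε = begin
        c           ≈⟨ identityˡ c ⟨
        ε ∙ c       ≈⟨ ∙-congʳ ab≈ε ⟨
        (a ∙ b) ∙ c ≈⟨ assoc a b c ⟩
        a ∙ (b ∙ c) ∎

    ◁-correct : ∀ ℓ w → ⟦ ℓ ◁ w ⟧ʷ ≈ ⟦ ℓ ⟧ˡ ∙ ⟦ w ⟧ʷ
    ◁-correct ℓ [] = refl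
    ◁-correct (i ⁺) (j ⁺ ∷ w) = refl
    ◁-correct (i ⁻) (j ⁻ ∷ w) = refl
    ◁-correct (i ⁺) (j ⁻ ∷ w) with i ≟ j
    ... | yes ≡.refl = cancel ⟦ w ⟧ʷ (inverseʳ (lookup ρ i))
    ... | no _     = refl
    ◁-correct (i ⁻) (j ⁺ ∷ w) with i ≟ j
    ... | yes ≡.refl = cancel ⟦ w ⟧ʷ (inverseˡ (lookup ρ i))
    ... | no _     = refl

    ·-correct : ∀ u v → ⟦ u · v ⟧ʷ ≈ ⟦ u ⟧ʷ ∙ ⟦ v ⟧ʷ
    ·-correct [] v = sym (identityˡ ⟦ v ⟧ʷ)
    ·-correct (ℓ ∷ u) v = begin
      ⟦ ℓ ◁ (u · v) ⟧ʷ            ≈⟨ ◁-correct ℓ (u · v) ⟩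
      ⟦ ℓ ⟧ˡ ∙ ⟦ u · v ⟧ʷ         ≈⟨ ∙-congˡ (·-correct u v) ⟩
      ⟦ ℓ ⟧ˡ ∙ (⟦ u ⟧ʷ ∙ ⟦ v ⟧ʷ)  ≈⟨ assoc _ _ _ ⟨
      (⟦ ℓ ⟧ˡ ∙ ⟦ u ⟧ʷ) ∙ ⟦ v ⟧ʷ  ∎

    invertLiteral-correct : ∀ ℓ → ⟦ invertLiteral ℓ ⟧ˡ ≈ ⟦ ℓ ⟧ˡ ⁻¹
    invertLiteral-correct (i ⁺) = refl
    invertLiteral-correct (i ⁻) = sym (⁻¹-involutive (lookup ρ i))

    invertFreeWord-correct : ∀ w → ⟦ invertFreeWord w ⟧ʷ ≈ ⟦ w ⟧ʷ ⁻¹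
    invertFreeWord-correct [] = sym ε⁻¹≈ε
    invertFreeWord-correct (ℓ ∷ w) = begin
      ⟦ invertFreeWord w · (invertLiteral ℓ ∷ []) ⟧ʷ     ≈⟨ ·-correct (invertFreeWord w) _ ⟩
      ⟦ invertFreeWord w ⟧ʷ ∙ (⟦ invertLiteral ℓ ⟧ˡ ∙ ε) ≈⟨ ∙-cong (invertFreeWord-correct w) (identityʳ _) ⟩
      ⟦ w ⟧ʷ ⁻¹ ∙ ⟦ invertLiteral ℓ ⟧ˡ              ≈⟨ ∙-congˡ (invertLiteral-correct ℓ) ⟩
      ⟦ w ⟧ʷ ⁻¹ ∙ ⟦ ℓ ⟧ˡ ⁻¹                        ≈⟨ ⁻¹-anti-homo-∙ ⟦ ℓ ⟧ˡ ⟦ w ⟧ʷ ⟨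
      (⟦ ℓ ⟧ˡ ∙ ⟦ w ⟧ʷ) ⁻¹                         ∎

    normalise-correct : ∀ e → ⟦ normalise e ⟧ʷ ≈ ⟦ e ⟧ ρ
    normalise-correct (var i) = identityʳ (lookup ρ i)
    normalise-correct id      = refl
    normalise-correct (a ⊕ b) =
      trans (·-correct (normalise a) (normalise b)) (∙-cong (normalise-correct a) (normalise-correct b))
    normalise-correct (⊝ a)   =
      trans (invertFreeWord-correct (normalise a)) (⁻¹-cong (normalise-correct a))

  open import Relation.Binary.Reflection setoid var ⟦_⟧ (λ e ρ → ⟦_⟧ʷ ρ (normalise e))
    (λ e ρ → normalise-correct ρ e) public
    using (_⊜_; close)

  prove : ∀ {n} (e₁ e₂ : Expr n) → normalise e₁ ≡ normalise e₂ → ∀ ρ → ⟦ e₁ ⟧ ρ ≈ ⟦ e₂ ⟧ ρ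
  prove e₁ e₂ same-normal-form ρ = begin
    ⟦ e₁ ⟧ ρ                ≈⟨ normalise-correct ρ e₁ ⟨
    ⟦_⟧ʷ ρ (normalise e₁)   ≡⟨ ≡.cong (⟦_⟧ʷ ρ) same-normal-form ⟩
    ⟦_⟧ʷ ρ (normalise e₂)   ≈⟨ normalise-correct ρ e₂ ⟩
    ⟦ e₂ ⟧ ρ                ∎

  -- unlike Relation.Binary.Reflection.solve, the hypothesis is an equality of words, so it never
  -- asks Agda to infer the implicit argument of a setoid reflexivity proof
  solve : ∀ n (f : N-ary n (Expr n) (Expr n × Expr n)) →
          normalise (proj₁ (close n f)) ≡ normalise (proj₂ (close n f)) →
          Eq n _≈_ (curryⁿ ⟦ proj₁ (close n f) ⟧) (curryⁿ ⟦ proj₂ (close n f) ⟧)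
  solve n f same-normal-form =
    curryⁿ-cong _≈_ ⟦ proj₁ (close n f) ⟧ ⟦ proj₂ (close n f) ⟧
      (prove (proj₁ (close n f)) (proj₂ (close n f)) same-normal-form)

odd⇒≡1+q*2 : ∀ {n} → ¬ 2 ∣ n → ∃ λ q → n ≡ suc (q * 2)
odd⇒≡1+q*2 {zero}        n-odd = ⊥-elim (n-odd (divides 0 ≡.refl))
odd⇒≡1+q*2 {suc zero}    _     = 0 , ≡.refl
odd⇒≡1+q*2 {suc (suc n)} n-odd =
  let (q , n≡1+q*2) = odd⇒≡1+q*2 {n} (n-odd ∘ 2∣n⇒2∣2+n) in suc q , ≡.cong (2 +_) n≡1+q*2
  where
  2∣n⇒2∣2+n : 2 ∣ n → 2 ∣ 2 + n
  2∣n⇒2∣2+n (divides q n≡q*2) = divides (suc q) (≡.cong (2 +_) n≡q*2)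

module GroupProperties (G : Group 0ℓ 0ℓ) where

  open Group G
  open GroupSolver G
  open import Algebra.Properties.Monoid.Mult monoid using (×-congʳ; ×-assocˡ; ×-homo-+) renaming (_×_ to _×ₘ_)
  open import Relation.Binary.Reasoning.Setoid setoid

  ⟨⟩-minimal : ∀ {gens P} → IsSubgroup G P → (∀ {γ} → γ ∈ gens → P γ) → ∀ {a} → ⟨ G ⟩ gens a → P a
  ⟨⟩-minimal P≤G gens⊆P (gen γ∈)   = gens⊆P γ∈
  ⟨⟩-minimal P≤G gens⊆P one        = IsSubgroup.ε∈ P≤G
  ⟨⟩-minimal P≤G gens⊆P (mul a b)  = IsSubgroup.∙∈ P≤G (⟨⟩-minimal P≤G gens⊆P a) (⟨⟩-minimal P≤G gens⊆P b)
  ⟨⟩-minimal P≤G gens⊆P (inv a)    = IsSubgroup.⁻¹∈ P≤G (⟨⟩-minimal P≤G gens⊆P a)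
  ⟨⟩-minimal P≤G gens⊆P (resp e a) = IsSubgroup.resp P≤G e (⟨⟩-minimal P≤G gens⊆P a)

  module _ {gens : List Carrier} where

    Generated : Group 0ℓ 0ℓ
    Generated = subgroupGroup G (⟨ G ⟩ gens) (⟨⟩-isSubgroup G gens)

    generated-induction : (P : Group.Carrier Generated → Set) → IsSubgroup Generated P →
                          (∀ {γ} (γ∈ : γ ∈ gens) → P (γ , gen γ∈)) → ∀ z → P z
    generated-induction P P≤ P-gens (a , a∈) = P.resp refl (proj₂ (⟨⟩-minimal P′≤G (λ γ∈ → gen γ∈ , P-gens γ∈) a∈))
      where
      module P = IsSubgroup P≤
      P′ : Carrier → Set
      P′ a = ∃ λ (a∈ : ⟨ G ⟩ gens a) → P (a , a∈)
      P′≤G : IsSubgroup G P′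
      P′≤G = record
        { resp = λ { a≈b (a∈ , Pa) → resp a≈b a∈ , P.resp a≈b Pa }
        ; ε∈  = one , P.ε∈
        ; ∙∈  = λ { (a∈ , Pa) (b∈ , Pb) → mul a∈ b∈ , P.∙∈ Pa Pb }
        ; ⁻¹∈ = λ { (a∈ , Pa) → inv a∈ , P.⁻¹∈ Pa }
        }

  Central : Carrier → Set
  Central a = ∀ b → a ∙ b ≈ b ∙ a

  central-isNormal : IsNormalSubgroup G Central
  central-isNormal = record
    { isSubgroup = record
      { resp = λ a≈a′ a-central b → trans (∙-congʳ (sym a≈a′)) (trans (a-central b) (∙-congˡ a≈a′))
      ; ε∈  = λ b → trans (identityˡ b) (sym (identityʳ b))
      ; ∙∈  = λ {a} {c} a-central c-central b → begin
          a ∙ c ∙ b   ≈⟨ solve 3 (λ a b c → a ⊕ c ⊕ b ⊜ a ⊕ (c ⊕ b)) ≡.refl a b c ⟩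
          a ∙ (c ∙ b) ≈⟨ ∙-congˡ (c-central b) ⟩
          a ∙ (b ∙ c) ≈⟨ solve 3 (λ a b c → a ⊕ (b ⊕ c) ⊜ a ⊕ b ⊕ c) ≡.refl a b c ⟩
          a ∙ b ∙ c   ≈⟨ ∙-congʳ (a-central b) ⟩
          b ∙ a ∙ c   ≈⟨ solve 3 (λ a b c → b ⊕ a ⊕ c ⊜ b ⊕ (a ⊕ c)) ≡.refl a b c ⟩
          b ∙ (a ∙ c) ∎
      ; ⁻¹∈ = λ {a} a-central b → begin
          a ⁻¹ ∙ b             ≈⟨ solve 2 (λ a b → ⊝ a ⊕ b ⊜ ⊝ a ⊕ (b ⊕ a) ⊕ ⊝ a) ≡.refl a b ⟩
          a ⁻¹ ∙ (b ∙ a) ∙ a ⁻¹ ≈⟨ ∙-congʳ (∙-congˡ (a-central b)) ⟨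
          a ⁻¹ ∙ (a ∙ b) ∙ a ⁻¹ ≈⟨ solve 2 (λ a b → ⊝ a ⊕ (a ⊕ b) ⊕ ⊝ a ⊜ b ⊕ ⊝ a) ≡.refl a b ⟩
          b ∙ a ⁻¹             ∎
      }
    ; conj = λ c {a} a-central b →
        let c∙a∙c⁻¹≈a = trans (∙-congʳ (sym (a-central c))) (solve 2 (λ a c → a ⊕ c ⊕ ⊝ c ⊜ a) ≡.refl a c)
        in trans (∙-congʳ c∙a∙c⁻¹≈a) (trans (a-central b) (∙-congˡ (sym c∙a∙c⁻¹≈a)))
    }

  simple∧nonAbelian⇒centreless : IsSimple G → IsNonAbelian G → ∀ a → Central a → a ≈ ε
  simple∧nonAbelian⇒centreless (_ , normal⇒trivial⊎all) (a , b , ab≉ba) with normal⇒trivial⊎all Central central-isNormal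
  ... | inj₁ trivial = trivial
  ... | inj₂ all     = ⊥-elim (ab≉ba (all a b))

  [_,_] : Carrier → Carrier → Carrier
  [ a , b ] = a ⁻¹ ∙ b ⁻¹ ∙ a ∙ b

  [,]-cong : ∀ {a a′ b b′} → a ≈ a′ → b ≈ b′ → [ a , b ] ≈ [ a′ , b′ ]
  [,]-cong a≈a′ b≈b′ = ∙-cong (∙-cong (∙-cong (⁻¹-cong a≈a′) (⁻¹-cong b≈b′)) a≈a′) b≈b′

  [ε,_] : ∀ b → [ ε , b ] ≈ ε
  [ε, b ] = solve 1 (λ b → ⊝ id ⊕ ⊝ b ⊕ id ⊕ b ⊜ id) ≡.refl b

  [_,ε] : ∀ a → [ a , ε ] ≈ ε
  [ a ,ε] = solve 1 (λ a → ⊝ a ⊕ ⊝ id ⊕ a ⊕ id ⊜ id) ≡.refl a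

  [,]≈ε⇒central : ∀ {a} → (∀ b → [ a , b ] ≈ ε) → Central a
  [,]≈ε⇒central {a} [a,-]≈ε b = begin
    a ∙ b                ≈⟨ solve 2 (λ a b → a ⊕ b ⊜ b ⊕ a ⊕ (⊝ a ⊕ ⊝ b ⊕ a ⊕ b)) ≡.refl a b ⟩
    b ∙ a ∙ [ a , b ]    ≈⟨ ∙-congˡ ([a,-]≈ε b) ⟩
    b ∙ a ∙ ε            ≈⟨ identityʳ _ ⟩
    b ∙ a                ∎

  pow≈× : ∀ z n → pow G z n ≈ n ×ₘ z
  pow≈× z zero    = refl
  pow≈× z (suc n) = ∙-congˡ (pow≈× z n)

  pow-ε : ∀ {z} m {n} → pow G z n ≈ ε → pow G (pow G z m) n ≈ ε
  pow-ε {z} m {n} zⁿ≈ε = begin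
    pow G (pow G z m) n ≈⟨ trans (pow≈× _ n) (×-congʳ n (pow≈× z m)) ⟩
    n ×ₘ (m ×ₘ z)        ≈⟨ ×-assocˡ z n m ⟩
    (n * m) ×ₘ z        ≡⟨ ≡.cong (_×ₘ z) (ℕₚ.*-comm n m) ⟩
    (m * n) ×ₘ z        ≈⟨ ×-assocˡ z m n ⟨
    m ×ₘ (n ×ₘ z)        ≈⟨ ×-congʳ m (trans (sym (pow≈× z n)) zⁿ≈ε) ⟩
    m ×ₘ ε              ≈⟨ sym (pow≈× ε m) ⟩
    pow G ε m          ≈⟨ ε-pow m ⟩
    ε                  ∎
    where
    ε-pow : ∀ m → pow G ε m ≈ ε
    ε-pow zero    = refl
    ε-pow (suc m) = trans (identityˡ _) (ε-pow m)

  -- z = z ∙ zⁿ = (z²)^((n+1)/2)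
  odd-order⇒∈⟨square⟩ : ∀ {P z n} → IsSubgroup G P → pow G z n ≈ ε → ¬ 2 ∣ n → P (pow G z 2) → P z
  odd-order⇒∈⟨square⟩ {P} {z} {n} P≤G zⁿ≈ε n-odd P[z²] with odd⇒≡1+q*2 n-odd
  ... | q , ≡.refl = IsSubgroup.resp P≤G z²ᑫ⁺¹≈z (powers (suc q))
    where
    powers : ∀ k → P (pow G (pow G z 2) k)
    powers zero    = IsSubgroup.ε∈ P≤G
    powers (suc k) = IsSubgroup.∙∈ P≤G P[z²] (powers k)
    z²ᑫ⁺¹≈z : pow G (pow G z 2) (suc q) ≈ z
    z²ᑫ⁺¹≈z = begin
      pow G (pow G z 2) (suc q) ≈⟨ trans (pow≈× _ (suc q)) (×-congʳ (suc q) (pow≈× z 2)) ⟩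
      suc q ×ₘ (2 ×ₘ z)          ≈⟨ ×-assocˡ z (suc q) 2 ⟩
      (suc q * 2) ×ₘ z          ≈⟨ ×-homo-+ z 1 (suc (q * 2)) ⟩
      1 ×ₘ z ∙ suc (q * 2) ×ₘ z  ≈⟨ ∙-cong (identityʳ z) (trans (sym (pow≈× z (suc (q * 2)))) zⁿ≈ε) ⟩
      z ∙ ε                    ≈⟨ identityʳ z ⟩
      z                        ∎

module _ (G H : Group 0ℓ 0ℓ) where

  private
    module G = Group G
    module H = Group H
  open import Algebra.Morphism.Structures using (module GroupMorphisms)
  open GroupMorphisms G.rawGroup H.rawGroup using (IsGroupIsomorphism)
  open import Function.Definitions using (Injective; StrictlySurjective)
  open import Function.Consequences using (strictlySurjective⇒surjective)
  open import Algebra.Properties.Group H using (inverseˡ-unique)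

  -- the unit and inverse laws of a homomorphism of groups follow from multiplicativity
  isGroupIsomorphism : (f : G.Carrier → H.Carrier) → (∀ {a b} → a G.≈ b → f a H.≈ f b) →
                       (∀ a b → f (a G.∙ b) H.≈ f a H.∙ f b) → Injective G._≈_ H._≈_ f →
                       StrictlySurjective H._≈_ f → IsGroupIsomorphism f
  isGroupIsomorphism f f-cong f-homo f-injective f-onto = record
    { isGroupMonomorphism = record
      { isGroupHomomorphism = record
        { isMonoidHomomorphism = record
          { isMagmaHomomorphism = record
            { isRelHomomorphism = record { cong = f-cong }
            ; homo = f-homo }
          ; ε-homo = ε-homo }
        ; ⁻¹-homo = λ a → inverseˡ-unique (f (a G.⁻¹)) (f a)
            (H.trans (H.sym (f-homo (a G.⁻¹) a)) (H.trans (f-cong (G.inverseˡ a)) ε-homo)) }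
      ; injective = f-injective }
    ; surjective = strictlySurjective⇒surjective H.trans f-cong f-onto }
    where
    open import Relation.Binary.Reasoning.Setoid H.setoid
    ε-homo : f G.ε H.≈ H.ε
    ε-homo = begin
      f G.ε                                 ≈⟨ H.identityʳ (f G.ε) ⟨
      f G.ε H.∙ H.ε                         ≈⟨ H.∙-congˡ (H.inverseʳ (f G.ε)) ⟨
      f G.ε H.∙ (f G.ε H.∙ f G.ε H.⁻¹)      ≈⟨ H.assoc _ _ _ ⟨
      f G.ε H.∙ f G.ε H.∙ f G.ε H.⁻¹        ≈⟨ H.∙-congʳ (H.sym (f-homo G.ε G.ε)) ⟩
      f (G.ε G.∙ G.ε) H.∙ f G.ε H.⁻¹        ≈⟨ H.∙-congʳ (f-cong (G.identityˡ G.ε)) ⟩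
      f G.ε H.∙ f G.ε H.⁻¹                  ≈⟨ H.inverseʳ (f G.ε) ⟩
      H.ε                                   ∎

module CosetGraphProperties (G : Group 0ℓ 0ℓ) {H : Group.Carrier G → Set} (H≤G : IsSubgroup G H)
                            (g : Group.Carrier G) where

  open Group G
  open GroupSolver G
  open IsSubgroup H≤G renaming (resp to H-resp; ε∈ to H-ε; ∙∈ to H-∙; ⁻¹∈ to H-⁻¹)
  open import Relation.Binary.Reasoning.Setoid setoid hiding (stop)

  Γ : Graph
  Γ = CosetGraph G H g

  open Graph Γ public using (Adj)

  infix 4 _≃_
  _≃_ : Carrier → Carrier → Set
  _≃_ = Graph._≃_ Γ

  private
    ≃-via : ∀ {h u v} → H h → h ≈ v ∙ u ⁻¹ → u ≃ v
    ≃-via h∈H h≈ = H-resp h≈ h∈H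

  ≈⇒≃ : ∀ {u v} → u ≈ v → u ≃ v
  ≈⇒≃ {u} {v} u≈v = ≃-via H-ε (trans (sym (inverseʳ u)) (∙-congʳ u≈v))

  ≃-refl : ∀ {u} → u ≃ u
  ≃-refl = ≈⇒≃ refl

  ≃-sym : ∀ {u v} → u ≃ v → v ≃ u
  ≃-sym {u} {v} u≃v = ≃-via (H-⁻¹ u≃v) (solve 2 (λ u v → ⊝ (v ⊕ ⊝ u) ⊜ u ⊕ ⊝ v) ≡.refl u v)

  ≃-trans : ∀ {u v w} → u ≃ v → v ≃ w → u ≃ w
  ≃-trans {u} {v} {w} u≃v v≃w =
    ≃-via (H-∙ v≃w u≃v) (solve 3 (λ u v w → (w ⊕ ⊝ v) ⊕ (v ⊕ ⊝ u) ⊜ w ⊕ ⊝ u) ≡.refl u v w)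

  H∙≃ : ∀ {h} u → H h → h ∙ u ≃ u
  H∙≃ {h} u h∈H = ≃-via (H-⁻¹ h∈H) (solve 2 (λ h u → ⊝ h ⊜ u ⊕ ⊝ (h ⊕ u)) ≡.refl h u)

  ≃-∙ʳ : ∀ {u v} a → u ≃ v → u ∙ a ≃ v ∙ a
  ≃-∙ʳ {u} {v} a u≃v = ≃-via u≃v (solve 3 (λ u v a → v ⊕ ⊝ u ⊜ v ⊕ a ⊕ ⊝ (u ⊕ a)) ≡.refl u v a)

  ≃-cancelʳ : ∀ {u v} a → u ∙ a ≃ v ∙ a → u ≃ v
  ≃-cancelʳ {u} {v} a ua≃va = ≃-trans (≈⇒≃ (solve 2 (λ u a → u ⊜ u ⊕ a ⊕ ⊝ a) ≡.refl u a))
    (≃-trans (≃-∙ʳ (a ⁻¹) ua≃va) (≈⇒≃ (solve 2 (λ v a → v ⊕ a ⊕ ⊝ a ⊜ v) ≡.refl v a)))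

  Adj⇒≃g∙ : ∀ {u w} → Adj u w → ∃ λ h → H h × w ≃ g ∙ h ∙ u
  Adj⇒≃g∙ {u} {w} (k , h , k∈H , h∈H , wu⁻¹≈kgh) = h , h∈H , ≃-sym (≃-via k∈H (begin
    k                                ≈⟨ solve 3 (λ k g h → k ⊜ k ⊕ g ⊕ h ⊕ ⊝ (g ⊕ h)) ≡.refl k g h ⟩
    k ∙ g ∙ h ∙ (g ∙ h) ⁻¹           ≈⟨ ∙-congʳ wu⁻¹≈kgh ⟨
    w ∙ u ⁻¹ ∙ (g ∙ h) ⁻¹            ≈⟨ solve 4 (λ w u g h → w ⊕ ⊝ u ⊕ ⊝ (g ⊕ h) ⊜ w ⊕ ⊝ (g ⊕ h ⊕ u)) ≡.refl w u g h ⟩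
    w ∙ (g ∙ h ∙ u) ⁻¹               ∎))

  ≃g∙⇒Adj : ∀ {u w h} → H h → w ≃ g ∙ h ∙ u → Adj u w
  ≃g∙⇒Adj {u} {w} {h} h∈H w≃ghu = _ , h , ≃-sym w≃ghu , h∈H ,
    solve 4 (λ w u g h → w ⊕ ⊝ u ⊜ (w ⊕ ⊝ (g ⊕ h ⊕ u)) ⊕ g ⊕ h) ≡.refl w u g h

  Adj-respˡ : ∀ {u u′ w} → u ≃ u′ → Adj u w → Adj u′ w
  Adj-respˡ {u} {u′} u≃u′ adj with Adj⇒≃g∙ adj
  ... | h , h∈H , w≃ghu = ≃g∙⇒Adj (H-∙ h∈H (≃-sym u≃u′)) (≃-trans w≃ghu (≈⇒≃ (solve 4
        (λ g h u u′ → g ⊕ h ⊕ u ⊜ g ⊕ (h ⊕ (u ⊕ ⊝ u′)) ⊕ u′) ≡.refl g h u u′)))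

  Adj-∙ʳ : ∀ {u w} a → Adj u w → Adj (u ∙ a) (w ∙ a)
  Adj-∙ʳ {u} {w} a adj with Adj⇒≃g∙ adj
  ... | h , h∈H , w≃ghu = ≃g∙⇒Adj h∈H (≃-trans (≃-∙ʳ a w≃ghu) (≈⇒≃ (assoc _ _ _)))

  Adj-sym : g ∙ g ≈ ε → ∀ {u w} → Adj u w → Adj w u
  Adj-sym g²≈ε {u} {w} (k , h , k∈H , h∈H , wu⁻¹≈kgh) = h ⁻¹ , k ⁻¹ , H-⁻¹ h∈H , H-⁻¹ k∈H , (begin
    u ∙ w ⁻¹              ≈⟨ solve 2 (λ u w → u ⊕ ⊝ w ⊜ ⊝ (w ⊕ ⊝ u)) ≡.refl u w ⟩
    (w ∙ u ⁻¹) ⁻¹         ≈⟨ ⁻¹-cong wu⁻¹≈kgh ⟩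
    (k ∙ g ∙ h) ⁻¹        ≈⟨ solve 3 (λ k g h → ⊝ (k ⊕ g ⊕ h) ⊜ ⊝ h ⊕ ⊝ g ⊕ ⊝ k) ≡.refl k g h ⟩
    h ⁻¹ ∙ g ⁻¹ ∙ k ⁻¹    ≈⟨ ∙-congʳ (∙-congˡ g⁻¹≈g) ⟩
    h ⁻¹ ∙ g ∙ k ⁻¹       ∎)
    where
    open import Algebra.Properties.Group G using (inverseˡ-unique)
    g⁻¹≈g : g ⁻¹ ≈ g
    g⁻¹≈g = sym (inverseˡ-unique g g g²≈ε)

  Adj-irrefl : ¬ H g → ∀ v → ¬ Adj v v
  Adj-irrefl g∉H v (k , h , k∈H , h∈H , vv⁻¹≈kgh) = g∉H (H-resp g≈ (H-∙ (H-⁻¹ k∈H) (H-⁻¹ h∈H)))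
    where
    g≈ : k ⁻¹ ∙ h ⁻¹ ≈ g
    g≈ = begin
      k ⁻¹ ∙ h ⁻¹                   ≈⟨ solve 2 (λ k h → ⊝ k ⊕ ⊝ h ⊜ ⊝ k ⊕ id ⊕ ⊝ h) ≡.refl k h ⟩
      k ⁻¹ ∙ ε ∙ h ⁻¹               ≈⟨ ∙-congʳ (∙-congˡ (trans (sym (inverseʳ v)) vv⁻¹≈kgh)) ⟩
      k ⁻¹ ∙ (k ∙ g ∙ h) ∙ h ⁻¹     ≈⟨ solve 3 (λ k g h → ⊝ k ⊕ (k ⊕ g ⊕ h) ⊕ ⊝ h ⊜ g) ≡.refl k g h ⟩
      g                             ∎

  module _ (g²≈ε : g ∙ g ≈ ε) where

    walk-snoc : ∀ {u v w} → Walk Γ u v → Adj v w → Walk Γ u w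
    walk-snoc (stop u≃v)     v~w = step (Adj-respˡ (≃-sym u≃v) v~w) (stop ≃-refl)
    walk-snoc (step u~x x⇝v) v~w = step u~x (walk-snoc x⇝v v~w)

    walk-sym : ∀ {u v} → Walk Γ u v → Walk Γ v u
    walk-sym (stop u≃v)     = stop (≃-sym u≃v)
    walk-sym (step u~x x⇝v) = walk-snoc (walk-sym x⇝v) (Adj-sym g²≈ε u~x)

    walk-trans : ∀ {u v w} → Walk Γ u v → Walk Γ v w → Walk Γ u w
    walk-trans (stop u≃v)     (stop v≃w)     = stop (≃-trans u≃v v≃w)
    walk-trans (stop u≃v)     (step v~x x⇝w) = step (Adj-respˡ (≃-sym u≃v) v~x) x⇝w
    walk-trans (step u~x x⇝v) v⇝w           = step u~x (walk-trans x⇝v v⇝w)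

    walk-respʳ : ∀ {u v w} → Walk Γ u v → v ≃ w → Walk Γ u w
    walk-respʳ u⇝v v≃w = walk-trans u⇝v (stop v≃w)

    Reachable : Carrier → Set
    Reachable z = ∀ u → Walk Γ u (z ∙ u)

    reachable-isSubgroup : IsSubgroup G Reachable
    reachable-isSubgroup = record
      { resp = λ a≈b a-reach u → walk-respʳ (a-reach u) (≈⇒≃ (∙-congʳ a≈b))
      ; ε∈  = λ u → stop (≈⇒≃ (sym (identityˡ u)))
      ; ∙∈  = λ {a} {b} a-reach b-reach u →
          walk-respʳ (walk-trans (b-reach u) (a-reach (b ∙ u))) (≈⇒≃ (sym (assoc a b u)))
      ; ⁻¹∈ = λ {a} a-reach u → walk-sym (walk-respʳ (a-reach (a ⁻¹ ∙ u))
          (≈⇒≃ (solve 2 (λ a u → a ⊕ (⊝ a ⊕ u) ⊜ u) ≡.refl a u)))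
      }

    H-reachable : ∀ {h} → H h → Reachable h
    H-reachable h∈H u = stop (≃-sym (H∙≃ u h∈H))

    g-reachable : Reachable g
    g-reachable u = step (≃g∙⇒Adj H-ε (≈⇒≃ (∙-congʳ (sym (identityʳ g))))) (stop ≃-refl)

    all-reachable⇒connected : (∀ z → Reachable z) → Connected Γ
    all-reachable⇒connected reach u v = walk-respʳ (reach (v ∙ u ⁻¹) u)
      (≈⇒≃ (solve 2 (λ u v → v ⊕ ⊝ u ⊕ u ⊜ v) ≡.refl u v))

  twoArcTransitive-via-base : ∀ b₀ b₁ b₂ →
    (∀ u₀ u₁ u₂ → Is2Arc Γ u₀ u₁ u₂ → ∃ λ a → (u₀ ∙ a ≃ b₀) × (u₁ ∙ a ≃ b₁) × (u₂ ∙ a ≃ b₂)) →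
    TwoArcTransitive Γ _∙_
  twoArcTransitive-via-base b₀ b₁ b₂ to-base u₀ u₁ u₂ v₀ v₁ v₂ u-arc v-arc
    with to-base u₀ u₁ u₂ u-arc | to-base v₀ v₁ v₂ v-arc
  ... | a , ua₀ , ua₁ , ua₂ | b , vb₀ , vb₁ , vb₂ = a ∙ b ⁻¹ , back ua₀ vb₀ , back ua₁ vb₁ , back ua₂ vb₂
    where
    back : ∀ {u v c} → u ∙ a ≃ c → v ∙ b ≃ c → u ∙ (a ∙ b ⁻¹) ≃ v
    back {u} {v} ua≃c vb≃c = ≃-trans (≈⇒≃ (sym (assoc u a (b ⁻¹))))
      (≃-trans (≃-∙ʳ (b ⁻¹) (≃-trans ua≃c (≃-sym vb≃c))) (≈⇒≃ (solve 2 (λ v b → v ⊕ b ⊕ ⊝ b ⊜ v) ≡.refl v b)))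


⟨$⟩ʳ-injective : ∀ {n} (σ : Permutation′ n) {i j} → σ ⟨$⟩ʳ i ≡ σ ⟨$⟩ʳ j → i ≡ j
⟨$⟩ʳ-injective σ {i} {j} σi≡σj =
  ≡.trans (≡.sym (Perm.inverseˡ σ)) (≡.trans (≡.cong (σ ⟨$⟩ˡ_) σi≡σj) (Perm.inverseˡ σ))

infix 4 _≈ₚ?_
_≈ₚ?_ : ∀ {n} (σ τ : Permutation′ n) → Dec (σ Perm.≈ τ)
σ ≈ₚ? τ = all? λ i → σ ⟨$⟩ʳ i ≟ τ ⟨$⟩ʳ i

≈-off-last⇒≈ : ∀ {n} (ρ σ : Permutation′ (suc n)) →
               (∀ i → ρ ⟨$⟩ʳ inject₁ i ≡ σ ⟨$⟩ʳ inject₁ i) → ρ Perm.≈ σ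
≈-off-last⇒≈ {n} ρ σ agree k with n ℕₚ.≟ toℕ k
... | no n≢k = ≡.subst (λ k → ρ ⟨$⟩ʳ k ≡ σ ⟨$⟩ʳ k) (inject₁-lower₁ k n≢k) (agree (lower₁ k n≢k))
... | yes n≡k with n ℕₚ.≟ toℕ (σ ⟨$⟩ˡ (ρ ⟨$⟩ʳ k))
...   | yes n≡j = ≡.trans (≡.sym (Perm.inverseʳ σ))
                    (≡.cong (σ ⟨$⟩ʳ_) (toℕ-injective (≡.trans (≡.sym n≡j) n≡k)))
...   | no n≢j = ⊥-elim (n≢j (≡.trans n≡k (≡.cong toℕ k≡j)))
  where
  j = σ ⟨$⟩ˡ (ρ ⟨$⟩ʳ k)
  k≡j : k ≡ j
  k≡j = ⟨$⟩ʳ-injective ρ (begin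
    ρ ⟨$⟩ʳ k                          ≡⟨ Perm.inverseʳ σ ⟨
    σ ⟨$⟩ʳ j                          ≡⟨ ≡.cong (σ ⟨$⟩ʳ_) (inject₁-lower₁ j n≢j) ⟨
    σ ⟨$⟩ʳ inject₁ (lower₁ j n≢j)     ≡⟨ agree (lower₁ j n≢j) ⟨
    ρ ⟨$⟩ʳ inject₁ (lower₁ j n≢j)     ≡⟨ ≡.cong (ρ ⟨$⟩ʳ_) (inject₁-lower₁ j n≢j) ⟩
    ρ ⟨$⟩ʳ j                          ∎)
    where open ≡.≡-Reasoning

data Letter : Set where
  H₁ H₂ Δ : Letter

Word : Set
Word = List Letter

inverseLetter : Letter → Word
inverseLetter H₁ = H₁ ∷ H₁ ∷ []
inverseLetter H₂ = H₂ ∷ []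
inverseLetter Δ  = Δ ∷ []

inverseWord : Word → Word
inverseWord []      = []
inverseWord (ℓ ∷ w) = inverseWord w ++ inverseLetter ℓ

module WordEvaluation (G : Group 0ℓ 0ℓ) (⟦_⟧ : Letter → Group.Carrier G) where

  open Group G
  open import Relation.Binary.Reasoning.Setoid setoid
  open import Algebra.Properties.Group G using (⁻¹-anti-homo-∙; ε⁻¹≈ε)

  eval : Word → Carrier
  eval []      = ε
  eval (ℓ ∷ w) = ⟦ ℓ ⟧ ∙ eval w

  eval-++ : ∀ u w → eval (u ++ w) ≈ eval u ∙ eval w
  eval-++ []      w = sym (identityˡ (eval w))
  eval-++ (ℓ ∷ u) w = trans (∙-congˡ (eval-++ u w)) (sym (assoc ⟦ ℓ ⟧ (eval u) (eval w)))

  eval-inverseWord : (∀ ℓ → eval (inverseLetter ℓ) ≈ ⟦ ℓ ⟧ ⁻¹) → ∀ w → eval (inverseWord w) ≈ eval w ⁻¹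
  eval-inverseWord inverses []      = sym ε⁻¹≈ε
  eval-inverseWord inverses (ℓ ∷ w) = begin
    eval (inverseWord w ++ inverseLetter ℓ)        ≈⟨ eval-++ (inverseWord w) (inverseLetter ℓ) ⟩
    eval (inverseWord w) ∙ eval (inverseLetter ℓ)  ≈⟨ ∙-cong (eval-inverseWord inverses w) (inverses ℓ) ⟩
    eval w ⁻¹ ∙ ⟦ ℓ ⟧ ⁻¹                           ≈⟨ ⁻¹-anti-homo-∙ ⟦ ℓ ⟧ (eval w) ⟨
    (⟦ ℓ ⟧ ∙ eval w) ⁻¹                            ∎

-- The permutations h₁, h₂, δ of Defs live in Construction, whose parameters they do not use.
module PermutationGroupK (T : Group 0ℓ 0ℓ) (x y : Group.Carrier T) where

  open Construction T x y using (h₁; h₂; δ)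
  module S₆ = Group (Sym 6)
  module S₄ = Group (Sym 4)

  ⟦_⟧₆ : Letter → Permutation′ 6
  ⟦ H₁ ⟧₆ = h₁
  ⟦ H₂ ⟧₆ = h₂
  ⟦ Δ  ⟧₆ = δ

  -- the action on the right cosets of ⟨h₁, h₂⟩ in K, the coset of the j-th representative
  -- in cosetWord being labelled j
  ⟦_⟧₄ : Letter → Permutation′ 4
  ⟦ H₁ ⟧₄ = transpose 1F 2F ∘ₚ transpose 1F 3F
  ⟦ H₂ ⟧₄ = transpose 1F 2F
  ⟦ Δ  ⟧₄ = transpose 0F 3F

  open WordEvaluation (Sym 6) ⟦_⟧₆ public
    renaming (eval to eval₆; eval-++ to eval₆-++; eval-inverseWord to eval₆-inverseWord)
  open WordEvaluation (Sym 4) ⟦_⟧₄ public using () renaming (eval to eval₄; eval-++ to eval₄-++)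

  Index : Set
  Index = Fin 2 × Fin 3 × Fin 4

  stabiliserWord : Fin 2 → Fin 3 → Word
  stabiliserWord t c = replicate (toℕ t) H₂ ++ replicate (toℕ c) H₁

  cosetWord : Fin 4 → Word
  cosetWord 0F = []
  cosetWord 1F = Δ ∷ H₁ ∷ []
  cosetWord 2F = Δ ∷ H₁ ∷ H₁ ∷ []
  cosetWord 3F = Δ ∷ []

  normalWord : Index → Word
  normalWord (t , c , j) = stabiliserWord t c ++ cosetWord j

  N₆ : Index → Permutation′ 6
  N₆ n = eval₆ (normalWord n)

  N₄ : Index → Permutation′ 4
  N₄ n = eval₄ (normalWord n)

  ∀-Index? : {P : Index → Set} → (∀ n → Dec (P n)) → Dec (∀ n → P n)
  ∀-Index? P? = map′ (λ ∀P (t , c , j) → ∀P t c j) (λ ∀P t c j → ∀P (t , c , j))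
                     (all? λ t → all? λ c → all? λ j → P? (t , c , j))

  ∃-Index? : {P : Index → Set} → (∀ n → Dec (P n)) → Dec (∃ P)
  ∃-Index? P? = map′ (λ (t , c , j , p) → (t , c , j) , p) (λ ((t , c , j) , p) → t , c , j , p)
                     (any? λ t → any? λ c → any? λ j → P? (t , c , j))

  ∀-Letter? : {P : Letter → Set} → (∀ ℓ → Dec (P ℓ)) → Dec (∀ ℓ → P ℓ)
  ∀-Letter? P? = map′ (λ { (p₁ , p₂ , p₃) H₁ → p₁ ; (p₁ , p₂ , p₃) H₂ → p₂ ; (p₁ , p₂ , p₃) Δ → p₃ })
                      (λ ∀P → ∀P H₁ , ∀P H₂ , ∀P Δ) (P? H₁ ×-dec P? H₂ ×-dec P? Δ)

  firstIndex : {P : Index → Set} → (∀ n → Dec (P n)) → Index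
  firstIndex P? with ∃-Index? P?
  ... | yes (n , _) = n
  ... | no _        = 0F , 0F , 0F

  -- The searches and the facts decided below are opaque, as unfolding them during conversion
  -- checking is prohibitively slow.

  -- junk outside K; on K the images of 0 and 2 determine the element
  opaque
    locate₆ : Fin 6 → Fin 6 → Index
    locate₆ p q = firstIndex λ n → (N₆ n ⟨$⟩ʳ 0F ≟ p) ×-dec (N₆ n ⟨$⟩ʳ 2F ≟ q)

  index₆ : Permutation′ 6 → Index
  index₆ σ = locate₆ (σ ⟨$⟩ʳ 0F) (σ ⟨$⟩ʳ 2F)

  index₆-cong : ∀ {σ τ} → σ Perm.≈ τ → index₆ σ ≡ index₆ τ
  index₆-cong σ≈τ = ≡.cong₂ locate₆ (σ≈τ 0F) (σ≈τ 2F)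

  opaque
    locate₄ : Fin 4 → Fin 4 → Fin 4 → Index
    locate₄ a b c = firstIndex λ n → (N₄ n ⟨$⟩ʳ 0F ≟ a) ×-dec (N₄ n ⟨$⟩ʳ 1F ≟ b) ×-dec (N₄ n ⟨$⟩ʳ 2F ≟ c)

  index₄ : Permutation′ 4 → Index
  index₄ ρ = locate₄ (ρ ⟨$⟩ʳ 0F) (ρ ⟨$⟩ʳ 1F) (ρ ⟨$⟩ʳ 2F)

  index₄-cong : ∀ {ρ ρ′} → ρ Perm.≈ ρ′ → index₄ ρ ≡ index₄ ρ′
  index₄-cong ρ≈ρ′ = ≡.cong₂ (λ a (b , c) → locate₄ a b c) (ρ≈ρ′ 0F) (≡.cong₂ _,_ (ρ≈ρ′ 1F) (ρ≈ρ′ 2F))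

  opaque
    unfolding locate₆

    normalWords-closed : ∀ ℓ n → let m = index₆ (⟦ ℓ ⟧₆ ∘ₚ N₆ n) in
                         (⟦ ℓ ⟧₆ ∘ₚ N₆ n Perm.≈ N₆ m) × (⟦ ℓ ⟧₄ ∘ₚ N₄ n Perm.≈ N₄ m)
    normalWords-closed = toWitness {a? = ∀-Letter? λ ℓ → ∀-Index? λ n → let m = index₆ (⟦ ℓ ⟧₆ ∘ₚ N₆ n) in
                                   ⟦ ℓ ⟧₆ ∘ₚ N₆ n ≈ₚ? N₆ m ×-dec ⟦ ℓ ⟧₄ ∘ₚ N₄ n ≈ₚ? N₄ m} tt

    index₆-id : index₆ Perm.id ≡ (0F , 0F , 0F)
    index₆-id = ≡.refl

  eval-normal : ∀ w → (eval₆ w Perm.≈ N₆ (index₆ (eval₆ w))) × (eval₄ w Perm.≈ N₄ (index₆ (eval₆ w)))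
  eval-normal []      = ≡.subst (λ m → (Perm.id Perm.≈ N₆ m) × (Perm.id Perm.≈ N₄ m)) (≡.sym index₆-id)
                          ((λ _ → ≡.refl) , (λ _ → ≡.refl))
  eval-normal (ℓ ∷ w) =
      ≡.subst (λ m → ℓw₆ Perm.≈ N₆ m) m≡ (S₆.trans {ℓw₆} {ℓ∘N₆} {N₆ m} step₆ (proj₁ (normalWords-closed ℓ n)))
    , ≡.subst (λ m → ℓw₄ Perm.≈ N₄ m) m≡ (S₄.trans {ℓw₄} {ℓ∘N₄} {N₄ m} step₄ (proj₂ (normalWords-closed ℓ n)))
    where
    n : Index
    n = index₆ (eval₆ w)
    ℓw₆ ℓ∘N₆ : Permutation′ 6
    ℓw₆ = ⟦ ℓ ⟧₆ ∘ₚ eval₆ w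
    ℓ∘N₆ = ⟦ ℓ ⟧₆ ∘ₚ N₆ n
    m : Index
    m = index₆ ℓ∘N₆
    ℓw₄ ℓ∘N₄ : Permutation′ 4
    ℓw₄ = ⟦ ℓ ⟧₄ ∘ₚ eval₄ w
    ℓ∘N₄ = ⟦ ℓ ⟧₄ ∘ₚ N₄ n
    step₆ : ℓw₆ Perm.≈ ℓ∘N₆
    step₆ = S₆.∙-congˡ {⟦ ℓ ⟧₆} {eval₆ w} {N₆ n} (proj₁ (eval-normal w))
    step₄ : ℓw₄ Perm.≈ ℓ∘N₄
    step₄ = S₄.∙-congˡ {⟦ ℓ ⟧₄} {eval₄ w} {N₄ n} (proj₂ (eval-normal w))
    m≡ : m ≡ index₆ ℓw₆
    m≡ = index₆-cong {ℓ∘N₆} {ℓw₆} (S₆.sym {ℓw₆} {ℓ∘N₆} step₆)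

  InK : Permutation′ 6 → Set
  InK σ = σ Perm.≈ N₆ (index₆ σ)

  eval₆∈K : ∀ w → InK (eval₆ w)
  eval₆∈K w = proj₁ (eval-normal w)

  opaque
    inverseLetters₆ : ∀ ℓ → eval₆ (inverseLetter ℓ) Perm.≈ Perm.flip ⟦ ℓ ⟧₆
    inverseLetters₆ = toWitness {a? = ∀-Letter? λ ℓ → eval₆ (inverseLetter ℓ) ≈ₚ? Perm.flip ⟦ ℓ ⟧₆} tt

  K-resp : ∀ {σ τ} → σ Perm.≈ τ → InK σ → InK τ
  K-resp {σ} {τ} σ≈τ σ∈K i =
    ≡.trans (≡.sym (σ≈τ i)) (≡.trans (σ∈K i) (≡.cong (λ m → N₆ m ⟨$⟩ʳ i) (index₆-cong {σ} {τ} σ≈τ)))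

  ≈eval₆⇒∈K : ∀ {σ} w → σ Perm.≈ eval₆ w → InK σ
  ≈eval₆⇒∈K {σ} w σ≈w = K-resp {eval₆ w} {σ} (λ i → ≡.sym (σ≈w i)) (eval₆∈K w)

  word : Permutation′ 6 → Word
  word σ = normalWord (index₆ σ)

  ∘ₚ≈eval₆-++ : ∀ {σ τ} → InK σ → InK τ → σ ∘ₚ τ Perm.≈ eval₆ (word σ ++ word τ)
  ∘ₚ≈eval₆-++ {σ} {τ} σ∈K τ∈K i = begin
    τ ⟨$⟩ʳ (σ ⟨$⟩ʳ i)                          ≡⟨ ≡.cong (τ ⟨$⟩ʳ_) (σ∈K i) ⟩
    τ ⟨$⟩ʳ (N₆ (index₆ σ) ⟨$⟩ʳ i)              ≡⟨ τ∈K _ ⟩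
    N₆ (index₆ τ) ⟨$⟩ʳ (N₆ (index₆ σ) ⟨$⟩ʳ i)  ≡⟨ eval₆-++ (word σ) (word τ) i ⟨
    eval₆ (word σ ++ word τ) ⟨$⟩ʳ i            ∎
    where open ≡.≡-Reasoning

  flip≈eval₆-inverseWord : ∀ {σ} → InK σ → Perm.flip σ Perm.≈ eval₆ (inverseWord (word σ))
  flip≈eval₆-inverseWord {σ} σ∈K =
    S₆.trans {Perm.flip σ} {Perm.flip (N₆ (index₆ σ))} {eval₆ (inverseWord (word σ))}
      (S₆.⁻¹-cong {σ} {N₆ (index₆ σ)} σ∈K)
      (S₆.sym {eval₆ (inverseWord (word σ))} {Perm.flip (N₆ (index₆ σ))} (eval₆-inverseWord inverseLetters₆ (word σ)))

  K-isSubgroup : IsSubgroup (Sym 6) InK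
  K-isSubgroup = record
    { resp = λ {σ} {τ} → K-resp {σ} {τ}
    ; ε∈  = eval₆∈K []
    ; ∙∈  = λ {σ} {τ} σ∈K τ∈K → ≈eval₆⇒∈K {σ ∘ₚ τ} (word σ ++ word τ) (∘ₚ≈eval₆-++ {σ} {τ} σ∈K τ∈K)
    ; ⁻¹∈ = λ {σ} σ∈K → ≈eval₆⇒∈K {Perm.flip σ} (inverseWord (word σ)) (flip≈eval₆-inverseWord {σ} σ∈K)
    }

  ψ : Permutation′ 6 → Permutation′ 4
  ψ σ = N₄ (index₆ σ)

  ψ-cong : ∀ {σ τ} → σ Perm.≈ τ → ψ σ Perm.≈ ψ τ
  ψ-cong {σ} {τ} σ≈τ i = ≡.cong (λ m → N₄ m ⟨$⟩ʳ i) (index₆-cong {σ} {τ} σ≈τ)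

  ψ-eval : ∀ w → ψ (eval₆ w) Perm.≈ eval₄ w
  ψ-eval w i = ≡.sym (proj₂ (eval-normal w) i)

  ψ-homo : ∀ {σ τ} → InK σ → InK τ → ψ (σ ∘ₚ τ) Perm.≈ ψ σ ∘ₚ ψ τ
  ψ-homo {σ} {τ} σ∈K τ∈K = begin
    ψ (σ ∘ₚ τ)                        ≈⟨ ψ-cong {σ ∘ₚ τ} {eval₆ (word σ ++ word τ)} (∘ₚ≈eval₆-++ {σ} {τ} σ∈K τ∈K) ⟩
    ψ (eval₆ (word σ ++ word τ))      ≈⟨ ψ-eval (word σ ++ word τ) ⟩
    eval₄ (word σ ++ word τ)          ≈⟨ eval₄-++ (word σ) (word τ) ⟩
    ψ σ ∘ₚ ψ τ                        ∎
    where open import Relation.Binary.Reasoning.Setoid S₄.setoid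

  opaque
    unfolding locate₄

    index₄-N₄ : ∀ n → index₄ (N₄ n) ≡ n
    index₄-N₄ = toWitness {a? = ∀-Index? λ n → ≡-dec _≟_ (≡-dec _≟_ _≟_) (index₄ (N₄ n)) n} tt

    locate₄-correct : ∀ a b c → a ≢ b → a ≢ c → b ≢ c →
                      (N₄ (locate₄ a b c) ⟨$⟩ʳ 0F ≡ a) × (N₄ (locate₄ a b c) ⟨$⟩ʳ 1F ≡ b) × (N₄ (locate₄ a b c) ⟨$⟩ʳ 2F ≡ c)
    locate₄-correct = toWitness {a? = all? λ a → all? λ b → all? λ c →
      ¬? (a ≟ b) →-dec ¬? (a ≟ c) →-dec ¬? (b ≟ c) →-dec
      (N₄ (locate₄ a b c) ⟨$⟩ʳ 0F ≟ a) ×-dec (N₄ (locate₄ a b c) ⟨$⟩ʳ 1F ≟ b) ×-dec (N₄ (locate₄ a b c) ⟨$⟩ʳ 2F ≟ c)} tt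

  N₄-onto : ∀ ρ → ρ Perm.≈ N₄ (index₄ ρ)
  N₄-onto ρ = ≈-off-last⇒≈ ρ (N₄ (index₄ ρ)) agree
    where
    distinct : ∀ {i j} → i ≢ j → ρ ⟨$⟩ʳ i ≢ ρ ⟨$⟩ʳ j
    distinct i≢j = i≢j ∘ ⟨$⟩ʳ-injective ρ
    values = locate₄-correct (ρ ⟨$⟩ʳ 0F) (ρ ⟨$⟩ʳ 1F) (ρ ⟨$⟩ʳ 2F) (distinct (λ ())) (distinct (λ ())) (distinct (λ ()))
    agree : ∀ i → ρ ⟨$⟩ʳ inject₁ i ≡ N₄ (index₄ ρ) ⟨$⟩ʳ inject₁ i
    agree 0F = ≡.sym (proj₁ values)
    agree 1F = ≡.sym (proj₁ (proj₂ values))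
    agree 2F = ≡.sym (proj₂ (proj₂ values))

  ψ≈id⇒≈id : ∀ {σ} → InK σ → ψ σ Perm.≈ Perm.id → σ Perm.≈ Perm.id
  ψ≈id⇒≈id {σ} σ∈K ψσ≈id i = ≡.trans (σ∈K i) (≡.cong (λ m → N₆ m ⟨$⟩ʳ i) index≡0)
    where
    index≡0 : index₆ σ ≡ (0F , 0F , 0F)
    index≡0 = begin
      index₆ σ                  ≡⟨ index₄-N₄ (index₆ σ) ⟨
      index₄ (ψ σ)              ≡⟨ index₄-cong {ψ σ} {Perm.id} ψσ≈id ⟩
      index₄ Perm.id            ≡⟨ index₄-N₄ (0F , 0F , 0F) ⟩
      (0F , 0F , 0F)            ∎
      where open ≡.≡-Reasoning

  ≈id⇒ψ≈id : ∀ {σ} → σ Perm.≈ Perm.id → ψ σ Perm.≈ Perm.id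
  ≈id⇒ψ≈id {σ} σ≈id i = ≡.trans (ψ-cong {σ} {Perm.id} σ≈id i) (≡.cong (λ m → N₄ m ⟨$⟩ʳ i) index₆-id)

  opaque
    N₄-at-0 : ∀ n → N₄ n ⟨$⟩ʳ 0F ≡ proj₂ (proj₂ n)
    N₄-at-0 = toWitness {a? = ∀-Index? λ n → N₄ n ⟨$⟩ʳ 0F ≟ proj₂ (proj₂ n)} tt

  ψ-fixes-0⇒stabiliser : ∀ {σ} → InK σ → ψ σ ⟨$⟩ʳ 0F ≡ 0F → ∃₂ λ t c → σ Perm.≈ eval₆ (stabiliserWord t c)
  ψ-fixes-0⇒stabiliser {σ} σ∈K ψσ0≡0 = go (index₆ σ) σ∈K (≡.trans (≡.sym (N₄-at-0 (index₆ σ))) ψσ0≡0)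
    where
    go : ∀ n → σ Perm.≈ N₆ n → proj₂ (proj₂ n) ≡ 0F → ∃₂ λ t c → σ Perm.≈ eval₆ (stabiliserWord t c)
    go (t , c , _) σ≈N₆n ≡.refl =
      t , c , λ i → ≡.trans (σ≈N₆n i) (≡.cong (λ w → eval₆ w ⟨$⟩ʳ i) (++-identityʳ (stabiliserWord t c)))

  letter∈K : ∀ ℓ → InK ⟦ ℓ ⟧₆
  letter∈K ℓ = K-resp {eval₆ (ℓ ∷ [])} {⟦ ℓ ⟧₆} (λ _ → ≡.refl) (eval₆∈K (ℓ ∷ []))

  stabiliser₀-isSubgroup : IsSubgroup (Sym 6) (λ σ → InK σ × ψ σ ⟨$⟩ʳ 0F ≡ 0F)
  stabiliser₀-isSubgroup = record
    { resp = λ {σ} {τ} σ≈τ (σ∈K , ψσ0) → K-resp {σ} {τ} σ≈τ σ∈K , ≡.trans (≡.sym (ψ-cong {σ} {τ} σ≈τ 0F)) ψσ0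
    ; ε∈  = IsSubgroup.ε∈ K-isSubgroup , ≈id⇒ψ≈id {Perm.id} (λ _ → ≡.refl) 0F
    ; ∙∈  = λ {σ} {τ} (σ∈K , ψσ0) (τ∈K , ψτ0) → IsSubgroup.∙∈ K-isSubgroup {σ} {τ} σ∈K τ∈K ,
              ≡.trans (ψ-homo {σ} {τ} σ∈K τ∈K 0F) (≡.trans (≡.cong (ψ τ ⟨$⟩ʳ_) ψσ0) ψτ0)
    ; ⁻¹∈ = λ {σ} (σ∈K , ψσ0) → IsSubgroup.⁻¹∈ K-isSubgroup {σ} σ∈K , (begin
              ψ (Perm.flip σ) ⟨$⟩ʳ 0F                     ≡⟨ ≡.cong (ψ (Perm.flip σ) ⟨$⟩ʳ_) ψσ0 ⟨
              ψ (Perm.flip σ) ⟨$⟩ʳ (ψ σ ⟨$⟩ʳ 0F)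
                ≡⟨ ψ-homo {σ} {Perm.flip σ} σ∈K (IsSubgroup.⁻¹∈ K-isSubgroup {σ} σ∈K) 0F ⟨
              ψ (σ ∘ₚ Perm.flip σ) ⟨$⟩ʳ 0F                ≡⟨ ≈id⇒ψ≈id {σ ∘ₚ Perm.flip σ} (λ _ → Perm.inverseˡ σ) 0F ⟩
              0F                                          ∎)
    }
    where open ≡.≡-Reasoning

  blockOf : Fin 6 → Fin 3
  blockOf 0F = 0F
  blockOf 1F = 0F
  blockOf 2F = 1F
  blockOf 3F = 1F
  blockOf 4F = 2F
  blockOf 5F = 2F

  partner : Fin 6 → Fin 6
  partner 0F = 1F
  partner 1F = 0F
  partner 2F = 3F
  partner 3F = 2F
  partner 4F = 5F
  partner 5F = 4F

  opaque
    same-block⇒partner : ∀ a b → a ≢ b → blockOf a ≡ blockOf b → b ≡ partner a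
    same-block⇒partner = toWitness {a? = all? λ a → all? λ b →
      ¬? (a ≟ b) →-dec blockOf a ≟ blockOf b →-dec b ≟ partner a} tt

  -- K is transitive on points, preserving the blocks {0,1}, {2,3}, {4,5}
  opaque
    moves-0,1 : ∀ a → ∃ λ n → (N₆ n ⟨$⟩ʳ 0F ≡ a) × (N₆ n ⟨$⟩ʳ 1F ≡ partner a)
    moves-0,1 = toWitness {a? = all? λ a → ∃-Index? λ n → N₆ n ⟨$⟩ʳ 0F ≟ a ×-dec N₆ n ⟨$⟩ʳ 1F ≟ partner a} tt

  opaque
    unfolding locate₆

    -- … and on pairs of points from different blocks
    moves-0,2 : ∀ a b → blockOf a ≢ blockOf b → (N₆ (locate₆ a b) ⟨$⟩ʳ 0F ≡ a) × (N₆ (locate₆ a b) ⟨$⟩ʳ 2F ≡ b)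
    moves-0,2 = toWitness {a? = all? λ a → all? λ b → ¬? (blockOf a ≟ blockOf b) →-dec
      N₆ (locate₆ a b) ⟨$⟩ʳ 0F ≟ a ×-dec N₆ (locate₆ a b) ⟨$⟩ʳ 2F ≟ b} tt

module GroupY (T : Group 0ℓ 0ℓ) (x y : Group.Carrier T) where

  open Construction T x y
  open PermutationGroupK T x y
  module T = Group T
  module X = Group X
  module Y = Group Y

  π : Y.Carrier → Permutation′ 6
  π z = proj₂ (proj₁ z)

  coords : Y.Carrier → Fin 6 → T.Carrier
  coords z = proj₁ (proj₁ z)

  ⟦_⟧ʸ : Letter → Y.Carrier
  ⟦ H₁ ⟧ʸ = perm h₁ , gen (here ≡.refl)
  ⟦ H₂ ⟧ʸ = perm h₂ , gen (there (here ≡.refl))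
  ⟦ Δ  ⟧ʸ = gᵧ

  open WordEvaluation Y ⟦_⟧ʸ public renaming (eval to evalʸ; eval-++ to evalʸ-++)

  π-eval : ∀ w → π (evalʸ w) ≡ eval₆ w
  π-eval []       = ≡.refl
  π-eval (H₁ ∷ w) = ≡.cong (h₁ ∘ₚ_) (π-eval w)
  π-eval (H₂ ∷ w) = ≡.cong (h₂ ∘ₚ_) (π-eval w)
  π-eval (Δ  ∷ w) = ≡.cong (δ ∘ₚ_) (π-eval w)

  proj₂-preimage : ∀ {P} → IsSubgroup (Sym 6) P → IsSubgroup X (P ∘ proj₂)
  proj₂-preimage {P} P≤S₆ = record
    { resp = λ a≈b → P.resp (proj₂ a≈b)
    ; ε∈  = P.ε∈
    ; ∙∈  = P.∙∈
    ; ⁻¹∈ = P.⁻¹∈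
    }
    where module P = IsSubgroup P≤S₆

  π∈K : ∀ z → InK (π z)
  π∈K (a , a∈Y) = GroupProperties.⟨⟩-minimal X (proj₂-preimage K-isSubgroup) generators∈K a∈Y
    where
    generators∈K : ∀ {γ} → γ ∈ (perm h₁ ∷ perm h₂ ∷ g ∷ []) → InK (proj₂ γ)
    generators∈K (here ≡.refl)                 = letter∈K H₁
    generators∈K (there (here ≡.refl))         = letter∈K H₂
    generators∈K (there (there (here ≡.refl))) = letter∈K Δ

  ψʸ : Y.Carrier → Permutation′ 4
  ψʸ z = ψ (π z)

  ψʸ-cong : ∀ {a b} → a Y.≈ b → ψʸ a Perm.≈ ψʸ b
  ψʸ-cong {a} {b} a≈b = ψ-cong {π a} {π b} (proj₂ a≈b)

  ψʸ-homo : ∀ a b → ψʸ (a Y.∙ b) Perm.≈ ψʸ a ∘ₚ ψʸ b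
  ψʸ-homo a b = ψ-homo {π a} {π b} (π∈K a) (π∈K b)

  ψʸ-eval : ∀ w → ψʸ (evalʸ w) Perm.≈ eval₄ w
  ψʸ-eval w i = ≡.trans (≡.cong (λ σ → ψ σ ⟨$⟩ʳ i) (π-eval w)) (ψ-eval w i)

  M : Y.Carrier → Set
  M z = π z Perm.≈ Perm.id

  M-normal : IsNormalSubgroup Y M
  M-normal = record
    { isSubgroup = record
      { resp = λ a≈b a∈M i → ≡.trans (≡.sym (proj₂ a≈b i)) (a∈M i)
      ; ε∈  = λ _ → ≡.refl
      ; ∙∈  = λ {a} {b} a∈M b∈M i → ≡.trans (≡.cong (π b ⟨$⟩ʳ_) (a∈M i)) (b∈M i)
      ; ⁻¹∈ = λ {a} a∈M i → ≡.trans (≡.sym (a∈M _)) (Perm.inverseʳ (π a))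
      }
    ; conj = λ z {m} m∈M i → ≡.trans (≡.cong (π z ⟨$⟩ˡ_) (m∈M (π z ⟨$⟩ʳ i))) (Perm.inverseˡ (π z))
    }

  M⇔ψʸ≈id : ∀ z → (M z → ψʸ z Perm.≈ Perm.id) × (ψʸ z Perm.≈ Perm.id → M z)
  M⇔ψʸ≈id z = ≈id⇒ψ≈id {π z} , ψ≈id⇒≈id {π z} (π∈K z)

  ψʸ-⁻¹ : ∀ b → ψʸ (b Y.⁻¹) Perm.≈ Perm.flip (ψʸ b)
  ψʸ-⁻¹ b = inverseˡ-unique (ψʸ (b Y.⁻¹)) (ψʸ b) (begin
    ψʸ (b Y.⁻¹) ∘ₚ ψʸ b   ≈⟨ ψʸ-homo (b Y.⁻¹) b ⟨
    ψʸ (b Y.⁻¹ Y.∙ b)     ≈⟨ ψʸ-cong {b Y.⁻¹ Y.∙ b} {Y.ε} (Y.inverseˡ b) ⟩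
    ψʸ Y.ε                ≈⟨ proj₁ (M⇔ψʸ≈id Y.ε) (λ _ → ≡.refl) ⟩
    Perm.id               ∎)
    where
    open import Algebra.Properties.Group (Sym 4) using (inverseˡ-unique)
    open import Relation.Binary.Reasoning.Setoid S₄.setoid

  M[ab⁻¹]⇔ψʸa≈ψʸb : ∀ a b → (M (a Y.∙ b Y.⁻¹) → ψʸ a Perm.≈ ψʸ b) × (ψʸ a Perm.≈ ψʸ b → M (a Y.∙ b Y.⁻¹))
  M[ab⁻¹]⇔ψʸa≈ψʸb a b =
      (λ ab⁻¹∈M → x∙y⁻¹≈ε⇒x≈y (ψʸ a) (ψʸ b)
        (S₄.trans {ψʸ a ∘ₚ Perm.flip (ψʸ b)} {ψʸ (a Y.∙ b Y.⁻¹)} {Perm.id}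
          (S₄.sym {ψʸ (a Y.∙ b Y.⁻¹)} {ψʸ a ∘ₚ Perm.flip (ψʸ b)} ψʸ[ab⁻¹]≈) (proj₁ (M⇔ψʸ≈id (a Y.∙ b Y.⁻¹)) ab⁻¹∈M)))
    , (λ ψʸa≈ψʸb → proj₂ (M⇔ψʸ≈id (a Y.∙ b Y.⁻¹))
        (S₄.trans {ψʸ (a Y.∙ b Y.⁻¹)} {ψʸ a ∘ₚ Perm.flip (ψʸ b)} {Perm.id}
          ψʸ[ab⁻¹]≈ (x≈y⇒x∙y⁻¹≈ε {ψʸ a} {ψʸ b} ψʸa≈ψʸb)))
    where
    open import Algebra.Properties.Group (Sym 4) using (x∙y⁻¹≈ε⇒x≈y; x≈y⇒x∙y⁻¹≈ε)
    open import Relation.Binary.Reasoning.Setoid S₄.setoid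
    ψʸ[ab⁻¹]≈ : ψʸ (a Y.∙ b Y.⁻¹) Perm.≈ ψʸ a ∘ₚ Perm.flip (ψʸ b)
    ψʸ[ab⁻¹]≈ = begin
      ψʸ (a Y.∙ b Y.⁻¹)          ≈⟨ ψʸ-homo a (b Y.⁻¹) ⟩
      ψʸ a ∘ₚ ψʸ (b Y.⁻¹)        ≈⟨ S₄.∙-congˡ {ψʸ a} {ψʸ (b Y.⁻¹)} {Perm.flip (ψʸ b)} (ψʸ-⁻¹ b) ⟩
      ψʸ a ∘ₚ Perm.flip (ψʸ b)   ∎

  Y/M≅S₄ : quotientGroup Y M M-normal ≅ Sym 4
  Y/M≅S₄ = ψʸ , isGroupIsomorphism (quotientGroup Y M M-normal) (Sym 4) ψʸ
    (λ {a} {b} → proj₁ (M[ab⁻¹]⇔ψʸa≈ψʸb a b)) ψʸ-homo (λ {a} {b} → proj₂ (M[ab⁻¹]⇔ψʸa≈ψʸb a b))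
    λ ρ → evalʸ (normalWord (index₄ ρ)) ,
      S₄.trans {ψʸ (evalʸ (normalWord (index₄ ρ)))} {N₄ (index₄ ρ)} {ρ}
        (ψʸ-eval (normalWord (index₄ ρ))) (S₄.sym {ρ} {N₄ (index₄ ρ)} (N₄-onto ρ))

  H-isSubgroup : IsSubgroup Y H
  H-isSubgroup = record { resp = resp ; ε∈ = one ; ∙∈ = mul ; ⁻¹∈ = inv }

  Pure : X.Carrier → Set
  Pure a = ∀ i → proj₁ a i T.≈ T.ε

  pure-isSubgroup : IsSubgroup X Pure
  pure-isSubgroup = record
    { resp = λ a≈b a-pure i → T.trans (T.sym (proj₁ a≈b i)) (a-pure i)
    ; ε∈  = λ _ → T.refl
    ; ∙∈  = λ a-pure b-pure i → T.trans (T.∙-cong (a-pure i) (b-pure _)) (T.identityˡ T.ε)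
    ; ⁻¹∈ = λ a-pure i → T.trans (T.⁻¹-cong (a-pure _)) ε⁻¹≈ε
    }
    where open import Algebra.Properties.Group T using (ε⁻¹≈ε)

  module _ {P : X.Carrier → Set} (P≤X : IsSubgroup X P) (h₁∈P : P (perm h₁)) (h₂∈P : P (perm h₂)) where

    H-minimal : ∀ {a} → Hₓ a → P a
    H-minimal = GroupProperties.⟨⟩-minimal X P≤X λ { (here ≡.refl) → h₁∈P ; (there (here ≡.refl)) → h₂∈P }

  H-pure : ∀ {a} → Hₓ a → Pure a
  H-pure = H-minimal pure-isSubgroup (λ _ → T.refl) (λ _ → T.refl)

  H-fixes-0 : ∀ {a} → Hₓ a → ψ (proj₂ a) ⟨$⟩ʳ 0F ≡ 0F
  H-fixes-0 a∈H = proj₂ (H-minimal (proj₂-preimage stabiliser₀-isSubgroup)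
    (letter∈K H₁ , ψ-eval (H₁ ∷ []) 0F) (letter∈K H₂ , ψ-eval (H₂ ∷ []) 0F) a∈H)

  pure-π-injective : ∀ {a b} → Pure (proj₁ a) → Pure (proj₁ b) → π a Perm.≈ π b → a Y.≈ b
  pure-π-injective a-pure b-pure πa≈πb = (λ i → T.trans (a-pure i) (T.sym (b-pure i))) , πa≈πb

  h₁∈H : H ⟦ H₁ ⟧ʸ
  h₁∈H = gen (here ≡.refl)

  h₂∈H : H ⟦ H₂ ⟧ʸ
  h₂∈H = gen (there (here ≡.refl))

  h₁^ : Fin 3 → Y.Carrier
  h₁^ c = pow Y ⟦ H₁ ⟧ʸ (toℕ c)

  h₂^ : Fin 2 → Y.Carrier
  h₂^ t = pow Y ⟦ H₂ ⟧ʸ (toℕ t)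

  private
    pow≡eval : ∀ ℓ n → pow Y ⟦ ℓ ⟧ʸ n ≡ evalʸ (replicate n ℓ)
    pow≡eval ℓ zero    = ≡.refl
    pow≡eval ℓ (suc n) = ≡.cong (⟦ ℓ ⟧ʸ Y.∙_) (pow≡eval ℓ n)

    pow∈H : ∀ {h} → H h → ∀ n → H (pow Y h n)
    pow∈H h∈H zero    = one
    pow∈H h∈H (suc n) = mul h∈H (pow∈H h∈H n)

  π-h₂^∙h₁^ : ∀ t c → π (h₂^ t Y.∙ h₁^ c) Perm.≈ eval₆ (stabiliserWord t c)
  π-h₂^∙h₁^ t c i = ≡.trans (≡.cong₂ (λ a b → (π a ∘ₚ π b) ⟨$⟩ʳ i) (pow≡eval H₂ (toℕ t)) (pow≡eval H₁ (toℕ c)))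
    (≡.trans (≡.cong (_⟨$⟩ʳ i) (≡.cong₂ _∘ₚ_ (π-eval (replicate (toℕ t) H₂)) (π-eval (replicate (toℕ c) H₁))))
             (≡.sym (eval₆-++ (replicate (toℕ t) H₂) (replicate (toℕ c) H₁) i)))

  private
    ψʸ-fixes-0⇒π-stabiliser : ∀ z → ψʸ z ⟨$⟩ʳ 0F ≡ 0F → ∃₂ λ t c → π z Perm.≈ π (h₂^ t Y.∙ h₁^ c)
    ψʸ-fixes-0⇒π-stabiliser z ψz0≡0 with ψ-fixes-0⇒stabiliser {π z} (π∈K z) ψz0≡0
    ... | t , c , πz≈ = t , c , λ i → ≡.trans (πz≈ i) (≡.sym (π-h₂^∙h₁^ t c i))

  ψʸ-fixes-0⇒stabiliser : ∀ z → ψʸ z ⟨$⟩ʳ 0F ≡ 0F → ∃₂ λ t c → ψʸ z Perm.≈ ψʸ (h₂^ t Y.∙ h₁^ c)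
  ψʸ-fixes-0⇒stabiliser z ψz0≡0 = let (t , c , πz≈) = ψʸ-fixes-0⇒π-stabiliser z ψz0≡0 in
    t , c , ψ-cong {π z} {π (h₂^ t Y.∙ h₁^ c)} πz≈

  H-elements : ∀ {z} → H z → ∃₂ λ t c → z Y.≈ h₂^ t Y.∙ h₁^ c
  H-elements {z} z∈H with ψʸ-fixes-0⇒π-stabiliser z (H-fixes-0 z∈H)
  ... | t , c , πz≈ = t , c , pure-π-injective {z} {h₂^ t Y.∙ h₁^ c} (H-pure z∈H)
    (H-pure (mul (pow∈H h₂∈H (toℕ t)) (pow∈H h₁∈H (toℕ c)))) πz≈

  ψʸ-letter : ∀ ℓ → ψʸ ⟦ ℓ ⟧ʸ Perm.≈ ⟦ ℓ ⟧₄
  ψʸ-letter ℓ i = ≡.trans (ψ-cong {π ⟦ ℓ ⟧ʸ} {eval₆ (ℓ ∷ [])} (λ _ → π-letter ℓ) i) (ψ-eval (ℓ ∷ []) i)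
    where
    π-letter : ∀ ℓ {i} → π ⟦ ℓ ⟧ʸ ⟨$⟩ʳ i ≡ ⟦ ℓ ⟧₆ ⟨$⟩ʳ i
    π-letter H₁ = ≡.refl
    π-letter H₂ = ≡.refl
    π-letter Δ  = ≡.refl

  g-involution : x T.∙ x T.≈ T.ε → gᵧ Y.∙ gᵧ Y.≈ Y.ε
  g-involution x²≈ε = coordinates , δ-invol
    where
    coordinates : ∀ i → f i T.∙ f (δ-fun i) T.≈ T.ε
    coordinates 0F = T.inverseʳ y
    coordinates 1F = T.inverseˡ y
    coordinates 2F = T.inverseʳ y
    coordinates 3F = T.inverseˡ y
    coordinates 4F = x²≈ε
    coordinates 5F = x²≈ε

  g∉H : ¬ (y T.≈ T.ε) → ¬ H gᵧ
  g∉H y≉ε g∈H = y≉ε (H-pure g∈H 0F)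

  g∙h₂≈h₂∙g : gᵧ Y.∙ ⟦ H₂ ⟧ʸ Y.≈ ⟦ H₂ ⟧ʸ Y.∙ gᵧ
  g∙h₂≈h₂∙g = coordinates , toWitness {a? = δ ∘ₚ h₂ ≈ₚ? h₂ ∘ₚ δ} tt
    where
    -- f is constant on the orbits of h₂
    coordinates : ∀ i → f i T.∙ T.ε T.≈ T.ε T.∙ f (h₂-fun i)
    coordinates 0F = T.trans (T.identityʳ _) (T.sym (T.identityˡ _))
    coordinates 1F = T.trans (T.identityʳ _) (T.sym (T.identityˡ _))
    coordinates 2F = T.trans (T.identityʳ _) (T.sym (T.identityˡ _))
    coordinates 3F = T.trans (T.identityʳ _) (T.sym (T.identityˡ _))
    coordinates 4F = T.trans (T.identityʳ _) (T.sym (T.identityˡ _))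
    coordinates 5F = T.trans (T.identityʳ _) (T.sym (T.identityˡ _))

  h₁²∙h₂≈h₂∙h₁ : ⟦ H₁ ⟧ʸ Y.∙ (⟦ H₁ ⟧ʸ Y.∙ ⟦ H₂ ⟧ʸ) Y.≈ ⟦ H₂ ⟧ʸ Y.∙ ⟦ H₁ ⟧ʸ
  h₁²∙h₂≈h₂∙h₁ = pure-π-injective {⟦ H₁ ⟧ʸ Y.∙ (⟦ H₁ ⟧ʸ Y.∙ ⟦ H₂ ⟧ʸ)} {⟦ H₂ ⟧ʸ Y.∙ ⟦ H₁ ⟧ʸ}
    (H-pure (mul h₁∈H (mul h₁∈H h₂∈H))) (H-pure (mul h₂∈H h₁∈H))
    (toWitness {a? = h₁ ∘ₚ (h₁ ∘ₚ h₂) ≈ₚ? h₂ ∘ₚ h₁} tt)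

module CosetGraphs (G : Group 0ℓ 0ℓ) where

  open Group G

  module OnFourPoints
    {H : Carrier → Set} (H≤G : IsSubgroup G H) (g h₁ h₂ : Carrier) (h₁∈H : H h₁) (h₂∈H : H h₂)
    (H-elements : ∀ {h} → H h → ∃₂ λ (t : Fin 2) (c : Fin 3) → h ≈ pow G h₂ (toℕ t) ∙ pow G h₁ (toℕ c))
    (g∙h₂≈h₂∙g : g ∙ h₂ ≈ h₂ ∙ g)
    (h₁²∙h₂≈h₂∙h₁ : h₁ ∙ (h₁ ∙ h₂) ≈ h₂ ∙ h₁)
    where

    open GroupSolver G
    open IsSubgroup H≤G renaming (resp to H-resp; ε∈ to H-ε; ∙∈ to H-∙; ⁻¹∈ to H-⁻¹)
    open CosetGraphProperties G H≤G g public

    h₁^ : Fin 3 → Carrier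
    h₁^ c = pow G h₁ (toℕ c)

    h₂^ : Fin 2 → Carrier
    h₂^ t = pow G h₂ (toℕ t)

    pow∈H : ∀ {h} → H h → ∀ n → H (pow G h n)
    pow∈H h∈H zero    = H-ε
    pow∈H h∈H (suc n) = H-∙ h∈H (pow∈H h∈H n)

    g∙h₂ⁿ≈h₂ⁿ∙g : ∀ n → g ∙ pow G h₂ n ≈ pow G h₂ n ∙ g
    g∙h₂ⁿ≈h₂ⁿ∙g zero    = trans (identityʳ g) (sym (identityˡ g))
    g∙h₂ⁿ≈h₂ⁿ∙g (suc n) = begin
      g ∙ (h₂ ∙ pow G h₂ n)   ≈⟨ assoc g h₂ _ ⟨
      g ∙ h₂ ∙ pow G h₂ n     ≈⟨ ∙-congʳ g∙h₂≈h₂∙g ⟩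
      h₂ ∙ g ∙ pow G h₂ n     ≈⟨ assoc h₂ g _ ⟩
      h₂ ∙ (g ∙ pow G h₂ n)   ≈⟨ ∙-congˡ (g∙h₂ⁿ≈h₂ⁿ∙g n) ⟩
      h₂ ∙ (pow G h₂ n ∙ g)   ≈⟨ assoc h₂ _ g ⟨
      h₂ ∙ pow G h₂ n ∙ g     ∎
      where open import Relation.Binary.Reasoning.Setoid setoid

    neighbour : Carrier → Fin 3 → Carrier
    neighbour v c = g ∙ h₁^ c ∙ v

    adjacent-neighbour : ∀ v c → Adj v (neighbour v c)
    adjacent-neighbour v c = ≃g∙⇒Adj (pow∈H h₁∈H (toℕ c)) ≃-refl

    neighbours-complete : ∀ {v w} → Adj v w → ∃ λ c → w ≃ neighbour v c
    neighbours-complete {v} {w} v~w with Adj⇒≃g∙ v~w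
    ... | h , h∈H , w≃ghv with H-elements h∈H
    ...   | t , c , h≈h₂^t∙h₁^c = c , ≃-trans w≃ghv (≃-trans (≈⇒≃ ghv≈) (H∙≃ (neighbour v c) (pow∈H h₂∈H (toℕ t))))
      where
      ghv≈ : g ∙ h ∙ v ≈ h₂^ t ∙ neighbour v c
      ghv≈ = begin
        g ∙ h ∙ v                      ≈⟨ ∙-congʳ (∙-congˡ h≈h₂^t∙h₁^c) ⟩
        g ∙ (h₂^ t ∙ h₁^ c) ∙ v        ≈⟨ solve 4 (λ g a b v → g ⊕ (a ⊕ b) ⊕ v ⊜ (g ⊕ a) ⊕ (b ⊕ v)) ≡.refl g (h₂^ t) (h₁^ c) v ⟩
        (g ∙ h₂^ t) ∙ (h₁^ c ∙ v)      ≈⟨ ∙-congʳ (g∙h₂ⁿ≈h₂ⁿ∙g (toℕ t)) ⟩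
        (h₂^ t ∙ g) ∙ (h₁^ c ∙ v)      ≈⟨ solve 4 (λ g a b v → (a ⊕ g) ⊕ (b ⊕ v) ⊜ a ⊕ (g ⊕ b ⊕ v)) ≡.refl g (h₂^ t) (h₁^ c) v ⟩
        h₂^ t ∙ neighbour v c          ∎
        where open import Relation.Binary.Reasoning.Setoid setoid

    -- h₂ fixes the arc (H , Hg) and swaps the two 2-arcs that continue it
    neighbour-g-2∙h₂ : neighbour g 2F ∙ h₂ ≈ h₂ ∙ neighbour g 1F
    neighbour-g-2∙h₂ = begin
      g ∙ (h₁ ∙ (h₁ ∙ ε)) ∙ g ∙ h₂    ≈⟨ solve 3 (λ g a b → g ⊕ (a ⊕ (a ⊕ id)) ⊕ g ⊕ b ⊜ g ⊕ (a ⊕ a) ⊕ (g ⊕ b)) ≡.refl g h₁ h₂ ⟩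
      g ∙ (h₁ ∙ h₁) ∙ (g ∙ h₂)        ≈⟨ ∙-congˡ g∙h₂≈h₂∙g ⟩
      g ∙ (h₁ ∙ h₁) ∙ (h₂ ∙ g)        ≈⟨ solve 3 (λ g a b → g ⊕ (a ⊕ a) ⊕ (b ⊕ g) ⊜ g ⊕ (a ⊕ (a ⊕ b)) ⊕ g) ≡.refl g h₁ h₂ ⟩
      g ∙ (h₁ ∙ (h₁ ∙ h₂)) ∙ g        ≈⟨ ∙-congʳ (∙-congˡ h₁²∙h₂≈h₂∙h₁) ⟩
      g ∙ (h₂ ∙ h₁) ∙ g               ≈⟨ solve 3 (λ g a b → g ⊕ (b ⊕ a) ⊕ g ⊜ (g ⊕ b) ⊕ (a ⊕ g)) ≡.refl g h₁ h₂ ⟩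
      (g ∙ h₂) ∙ (h₁ ∙ g)             ≈⟨ ∙-congʳ g∙h₂≈h₂∙g ⟩
      (h₂ ∙ g) ∙ (h₁ ∙ g)             ≈⟨ solve 3 (λ g a b → (b ⊕ g) ⊕ (a ⊕ g) ⊜ b ⊕ (g ⊕ (a ⊕ id) ⊕ g)) ≡.refl g h₁ h₂ ⟩
      h₂ ∙ (g ∙ (h₁ ∙ ε) ∙ g)         ∎
      where open import Relation.Binary.Reasoning.Setoid setoid

    module _ (g²≈ε : g ∙ g ≈ ε) where

      private
        moved-arc : ∀ {u₀ u₁ c} → u₁ ≃ neighbour u₀ c →
                    (u₀ ∙ (h₁^ c ∙ u₀) ⁻¹ ≃ ε) × (u₁ ∙ (h₁^ c ∙ u₀) ⁻¹ ≃ g)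
        moved-arc {u₀} {u₁} {c} u₁≃ =
            ≃-trans (≈⇒≃ (solve 2 (λ h u → u ⊕ ⊝ (h ⊕ u) ⊜ ⊝ h ⊕ id) ≡.refl (h₁^ c) u₀)) (H∙≃ ε (H-⁻¹ (pow∈H h₁∈H (toℕ c))))
          , ≃-trans (≃-∙ʳ _ u₁≃) (≈⇒≃ (solve 3 (λ g h u → g ⊕ h ⊕ u ⊕ ⊝ (h ⊕ u) ⊜ g) ≡.refl g (h₁^ c) u₀))

        continued-by-h₂ : ∀ {u a v w} → u ∙ a ≃ v → v ∙ h₂ ≈ h₂ ∙ w → u ∙ (a ∙ h₂) ≃ w
        continued-by-h₂ {u} {a} {v} {w} ua≃v vh₂≈h₂w =
          ≃-trans (≈⇒≃ (sym (assoc u a h₂))) (≃-trans (≃-∙ʳ h₂ ua≃v) (≃-trans (≈⇒≃ vh₂≈h₂w) (H∙≃ w h₂∈H)))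

      2-arc-to-base : ∀ u₀ u₁ u₂ → Is2Arc Γ u₀ u₁ u₂ →
                      ∃ λ a → (u₀ ∙ a ≃ ε) × (u₁ ∙ a ≃ g) × (u₂ ∙ a ≃ neighbour g 1F)
      2-arc-to-base u₀ u₁ u₂ (u₀~u₁ , u₁~u₂ , u₀≄u₂) with neighbours-complete u₀~u₁
      ... | c₁ , u₁≃ = continue (neighbours-complete (Adj-respˡ u₁a≃g (Adj-∙ʳ a u₁~u₂)))
        where
        a = (h₁^ c₁ ∙ u₀) ⁻¹
        u₀a≃ε = proj₁ (moved-arc {u₀} {u₁} {c₁} u₁≃)
        u₁a≃g = proj₂ (moved-arc {u₀} {u₁} {c₁} u₁≃)
        continue : (∃ λ c → u₂ ∙ a ≃ neighbour g c) →
                   ∃ λ a → (u₀ ∙ a ≃ ε) × (u₁ ∙ a ≃ g) × (u₂ ∙ a ≃ neighbour g 1F)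
        continue (0F , u₂a≃) = ⊥-elim (u₀≄u₂ (≃-cancelʳ a (≃-trans u₀a≃ε (≃-sym (≃-trans u₂a≃ g∙ε∙g≃ε)))))
          where
          g∙ε∙g≃ε : neighbour g 0F ≃ ε
          g∙ε∙g≃ε = ≈⇒≃ (trans (solve 1 (λ g → g ⊕ id ⊕ g ⊜ g ⊕ g) ≡.refl g) g²≈ε)
        continue (1F , u₂a≃) = a , u₀a≃ε , u₁a≃g , u₂a≃
        continue (2F , u₂a≃) = a ∙ h₂
          , continued-by-h₂ u₀a≃ε (solve 1 (λ h → id ⊕ h ⊜ h ⊕ id) ≡.refl h₂)
          , continued-by-h₂ u₁a≃g g∙h₂≈h₂∙g
          , continued-by-h₂ u₂a≃ neighbour-g-2∙h₂

      twoArcTransitive : TwoArcTransitive Γ _∙_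
      twoArcTransitive = twoArcTransitive-via-base ε g (neighbour g 1F) 2-arc-to-base

    module FourPointLabelling
      (ψ : Carrier → Permutation′ 4)
      (ψ-cong : ∀ {a b} → a ≈ b → ψ a Perm.≈ ψ b)
      (ψ-homo : ∀ a b → ψ (a ∙ b) Perm.≈ ψ a ∘ₚ ψ b)
      {N : Carrier → Set} (N-normal : IsNormalSubgroup G N)
      (N⇔ψ≈id : ∀ z → (N z → ψ z Perm.≈ Perm.id) × (ψ z Perm.≈ Perm.id → N z))
      (h₁-fixes-0 : ψ h₁ ⟨$⟩ʳ 0F ≡ 0F) (h₂-fixes-0 : ψ h₂ ⟨$⟩ʳ 0F ≡ 0F)
      (stabiliser₀⊆ψ[H] : ∀ z → ψ z ⟨$⟩ʳ 0F ≡ 0F → ∃₂ λ t c → ψ z Perm.≈ ψ (h₂^ t ∙ h₁^ c))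
      (g-0↦3 : ψ g ⟨$⟩ʳ 0F ≡ 3F) (h₁-3↦1 : ψ h₁ ⟨$⟩ʳ 3F ≡ 1F) (h₁-1↦2 : ψ h₁ ⟨$⟩ʳ 1F ≡ 2F)
      where

      module N = IsNormalSubgroup N-normal
      open ≡.≡-Reasoning

      -- the N-orbit of the vertex Hz, as a vertex of K₄
      φ : Carrier → Fin 4
      φ z = ψ z ⟨$⟩ʳ 0F

      ψ-ε : ∀ i → ψ ε ⟨$⟩ʳ i ≡ i
      ψ-ε = proj₁ (N⇔ψ≈id ε) N.ε∈

      ψ-⁻¹ : ∀ a i → ψ (a ⁻¹) ⟨$⟩ʳ (ψ a ⟨$⟩ʳ i) ≡ i
      ψ-⁻¹ a i = ≡.trans (≡.sym (ψ-homo a (a ⁻¹) i)) (≡.trans (ψ-cong (inverseʳ a) i) (ψ-ε i))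

      φ-∙ : ∀ a b → φ (a ∙ b) ≡ ψ b ⟨$⟩ʳ φ a
      φ-∙ a b = ψ-homo a b 0F

      pow-fixes-0 : ∀ {h} → ψ h ⟨$⟩ʳ 0F ≡ 0F → ∀ n → φ (pow G h n) ≡ 0F
      pow-fixes-0 h-fixes-0 zero    = ψ-ε 0F
      pow-fixes-0 {h} h-fixes-0 (suc n) = ≡.trans (φ-∙ h (pow G h n))
        (≡.trans (≡.cong (ψ (pow G h n) ⟨$⟩ʳ_) h-fixes-0) (pow-fixes-0 h-fixes-0 n))

      H-fixes-0 : ∀ {h} → H h → φ h ≡ 0F
      H-fixes-0 h∈H with H-elements h∈H
      ... | t , c , h≈ = begin
        φ _                                  ≡⟨ ψ-cong h≈ 0F ⟩
        φ (h₂^ t ∙ h₁^ c)                     ≡⟨ φ-∙ (h₂^ t) (h₁^ c) ⟩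
        ψ (h₁^ c) ⟨$⟩ʳ φ (h₂^ t)              ≡⟨ ≡.cong (ψ (h₁^ c) ⟨$⟩ʳ_) (pow-fixes-0 h₂-fixes-0 (toℕ t)) ⟩
        φ (h₁^ c)                             ≡⟨ pow-fixes-0 h₁-fixes-0 (toℕ c) ⟩
        0F                                   ∎

      ≃⇒φ≡ : ∀ {u v} → u ≃ v → φ u ≡ φ v
      ≃⇒φ≡ {u} {v} u≃v = begin
        φ u                       ≡⟨ ≡.cong (ψ u ⟨$⟩ʳ_) (H-fixes-0 u≃v) ⟨
        ψ u ⟨$⟩ʳ φ (v ∙ u ⁻¹)      ≡⟨ φ-∙ (v ∙ u ⁻¹) u ⟨
        φ (v ∙ u ⁻¹ ∙ u)          ≡⟨ ψ-cong (solve 2 (λ u v → v ⊕ ⊝ u ⊕ u ⊜ v) ≡.refl u v) 0F ⟩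
        φ v                       ∎

      ΓN : Graph
      ΓN = normalQuotient Γ _∙_ N

      infix 4 _∼_
      _∼_ : Carrier → Carrier → Set
      _∼_ = Graph._≃_ ΓN

      ∼⇒φ≡ : ∀ {u v} → u ∼ v → φ u ≡ φ v
      ∼⇒φ≡ {u} {v} (n , n∈N , un≃v) = begin
        φ u               ≡⟨ proj₁ (N⇔ψ≈id n) n∈N (φ u) ⟨
        ψ n ⟨$⟩ʳ φ u       ≡⟨ φ-∙ u n ⟨
        φ (u ∙ n)         ≡⟨ ≃⇒φ≡ un≃v ⟩
        φ v               ∎

      φ≡⇒∼ : ∀ {u v} → φ u ≡ φ v → u ∼ v
      φ≡⇒∼ {u} {v} φu≡φv =
        let (t , c , ψz≈ψh) = stabiliser₀⊆ψ[H] z φz≡0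
        in witness (H-∙ (pow∈H h₂∈H (toℕ t)) (pow∈H h₁∈H (toℕ c))) ψz≈ψh
        where
        z = v ∙ u ⁻¹
        φz≡0 : φ z ≡ 0F
        φz≡0 = ≡.trans (φ-∙ v (u ⁻¹)) (≡.trans (≡.cong (ψ (u ⁻¹) ⟨$⟩ʳ_) (≡.sym φu≡φv)) (ψ-⁻¹ u 0F))
        -- u⁻¹ (h⁻¹ z) u is a conjugate of z h⁻¹ ∈ N and moves Hu to Hh⁻¹v = Hv
        witness : ∀ {h} → H h → ψ z Perm.≈ ψ h → u ∼ v
        witness {h} h∈H ψz≈ψh = u ⁻¹ ∙ (h ⁻¹ ∙ (z ∙ h ⁻¹) ∙ h ⁻¹ ⁻¹) ∙ u ⁻¹ ⁻¹ ,
          N.conj (u ⁻¹) (N.conj (h ⁻¹) zh⁻¹∈N) ,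
          ≃-trans (≈⇒≃ (solve 3 (λ u v h → u ⊕ (⊝ u ⊕ (⊝ h ⊕ (v ⊕ ⊝ u ⊕ ⊝ h) ⊕ ⊝ ⊝ h) ⊕ ⊝ ⊝ u) ⊜ ⊝ h ⊕ v)
                                ≡.refl u v h))
                  (H∙≃ v (H-⁻¹ h∈H))
          where
          zh⁻¹∈N : N (z ∙ h ⁻¹)
          zh⁻¹∈N = proj₂ (N⇔ψ≈id (z ∙ h ⁻¹)) λ i →
            ≡.trans (ψ-homo z (h ⁻¹) i) (≡.trans (≡.cong (ψ (h ⁻¹) ⟨$⟩ʳ_) (ψz≈ψh i)) (ψ-⁻¹ h i))

      label : Fin 3 → Fin 4
      label 0F = 3F
      label 1F = 1F
      label 2F = 2F

      label-injective : ∀ {i j} → label i ≡ label j → i ≡ j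
      label-injective {0F} {0F} _ = ≡.refl
      label-injective {1F} {1F} _ = ≡.refl
      label-injective {2F} {2F} _ = ≡.refl
      label-injective {0F} {1F} ()
      label-injective {0F} {2F} ()
      label-injective {1F} {0F} ()
      label-injective {1F} {2F} ()
      label-injective {2F} {0F} ()
      label-injective {2F} {1F} ()

      label≢0 : ∀ c → label c ≢ 0F
      label≢0 0F ()
      label≢0 1F ()
      label≢0 2F ()

      label-onto : ∀ r → r ≢ 0F → ∃ λ c → label c ≡ r
      label-onto 0F r≢0 = ⊥-elim (r≢0 ≡.refl)
      label-onto 1F _   = 1F , ≡.refl
      label-onto 2F _   = 2F , ≡.refl
      label-onto 3F _   = 0F , ≡.refl

      φ-neighbour : ∀ v c → φ (neighbour v c) ≡ ψ v ⟨$⟩ʳ label c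
      φ-neighbour v c = ≡.trans (φ-∙ (g ∙ h₁^ c) v) (≡.cong (ψ v ⟨$⟩ʳ_) (φ-g∙h₁^ c))
        where
        φ-g∙h₁^ : ∀ c → φ (g ∙ h₁^ c) ≡ label c
        φ-g∙h₁^ c = ≡.trans (φ-∙ g (h₁^ c)) (≡.trans (≡.cong (ψ (h₁^ c) ⟨$⟩ʳ_) g-0↦3) (h₁^-3 c))
          where
          h₁^-3 : ∀ c → ψ (h₁^ c) ⟨$⟩ʳ 3F ≡ label c
          h₁^-3 0F = ψ-ε 3F
          h₁^-3 1F = ≡.trans (ψ-homo h₁ ε 3F) (≡.trans (≡.cong (ψ ε ⟨$⟩ʳ_) h₁-3↦1) (ψ-ε 1F))
          h₁^-3 2F = ≡.trans (ψ-homo h₁ (h₁ ∙ ε) 3F) (≡.trans (≡.cong (ψ (h₁ ∙ ε) ⟨$⟩ʳ_) h₁-3↦1)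
                       (≡.trans (ψ-homo h₁ ε 1F) (≡.trans (≡.cong (ψ ε ⟨$⟩ʳ_) h₁-1↦2) (ψ-ε 2F))))

      adjacent⇒φ≢ : ∀ {u v} → Adj u v → φ u ≢ φ v
      adjacent⇒φ≢ {u} {v} u~v φu≡φv with neighbours-complete u~v
      ... | c , v≃ = label≢0 c (⟨$⟩ʳ-injective (ψ u) (begin
        ψ u ⟨$⟩ʳ label c    ≡⟨ φ-neighbour u c ⟨
        φ (neighbour u c)   ≡⟨ ≃⇒φ≡ v≃ ⟨
        φ v                 ≡⟨ φu≡φv ⟨
        φ u                 ∎))

      φ≢⇒neighbour : ∀ {u v} → φ u ≢ φ v → ∃ λ c → φ v ≡ φ (neighbour u c)
      φ≢⇒neighbour {u} {v} φu≢φv with label-onto (ψ u ⟨$⟩ˡ φ v) r≢0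
        where
        r≢0 : ψ u ⟨$⟩ˡ φ v ≢ 0F
        r≢0 r≡0 = φu≢φv (≡.trans (≡.cong (ψ u ⟨$⟩ʳ_) (≡.sym r≡0)) (Perm.inverseʳ (ψ u)))
      ... | c , label≡r = c , (begin
        φ v                       ≡⟨ Perm.inverseʳ (ψ u) ⟨
        ψ u ⟨$⟩ʳ (ψ u ⟨$⟩ˡ φ v)     ≡⟨ ≡.cong (ψ u ⟨$⟩ʳ_) label≡r ⟨
        ψ u ⟨$⟩ʳ label c           ≡⟨ φ-neighbour u c ⟨
        φ (neighbour u c)         ∎)

      neighbours-distinct : ∀ v {i j} → φ (neighbour v i) ≡ φ (neighbour v j) → i ≡ j
      neighbours-distinct v {i} {j} φ≡ =
        label-injective (⟨$⟩ʳ-injective (ψ v) (≡.trans (≡.sym (φ-neighbour v i)) (≡.trans φ≡ (φ-neighbour v j))))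

      adjacentN⇒φ≢ : ∀ {u v} → Graph.Adj ΓN u v → φ u ≢ φ v
      adjacentN⇒φ≢ (u′ , v′ , u∼u′ , v∼v′ , u′~v′) φu≡φv =
        adjacent⇒φ≢ u′~v′ (≡.trans (≡.sym (∼⇒φ≡ u∼u′)) (≡.trans φu≡φv (∼⇒φ≡ v∼v′)))

      φ≢⇒adjacentN : ∀ {u v} → φ u ≢ φ v → Graph.Adj ΓN u v
      φ≢⇒adjacentN {u} {v} φu≢φv with φ≢⇒neighbour φu≢φv
      ... | c , φv≡ = u , neighbour u c , φ≡⇒∼ ≡.refl , φ≡⇒∼ φv≡ , adjacent-neighbour u c

      valency-Γ : HasValency Γ 3
      valency-Γ v = neighbour v , adjacent-neighbour v ,
                    (λ i j nᵢ≃nⱼ → neighbours-distinct v (≃⇒φ≡ nᵢ≃nⱼ)) , λ w → neighbours-complete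

      valency-ΓN : HasValency ΓN 3
      valency-ΓN v = neighbour v , (λ c → φ≢⇒adjacentN (adjacent⇒φ≢ (adjacent-neighbour v c))) ,
                     (λ i j nᵢ∼nⱼ → neighbours-distinct v (∼⇒φ≡ nᵢ∼nⱼ)) ,
                     λ w v~w → let (c , φw≡) = φ≢⇒neighbour (adjacentN⇒φ≢ v~w) in c , φ≡⇒∼ φw≡

      ΓN≅K₄ : ΓN ≅ᴳ K4
      ΓN≅K₄ = φ , (λ u v → ∼⇒φ≡) , (λ u v → φ≡⇒∼) , onto , λ u v → adjacentN⇒φ≢ , φ≢⇒adjacentN
        where
        onto : ∀ r → ∃ λ u → φ u ≡ r
        onto 0F = ε , ψ-ε 0F
        onto 1F = neighbour ε 1F , ≡.trans (φ-neighbour ε 1F) (ψ-ε 1F)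
        onto 2F = neighbour ε 2F , ≡.trans (φ-neighbour ε 2F) (ψ-ε 2F)
        onto 3F = neighbour ε 0F , ≡.trans (φ-neighbour ε 0F) (ψ-ε 3F)

      isNCover : IsNCover Γ _∙_ N
      isNCover = three-orbits , 3 , valency-Γ , valency-ΓN
        where
        φ₀ : φ ε ≡ 0F
        φ₀ = ψ-ε 0F
        φ₃ : φ (neighbour ε 0F) ≡ 3F
        φ₃ = ≡.trans (φ-neighbour ε 0F) (ψ-ε 3F)
        φ₁ : φ (neighbour ε 1F) ≡ 1F
        φ₁ = ≡.trans (φ-neighbour ε 1F) (ψ-ε 1F)
        three-orbits : AtLeast3Vertices ΓN
        three-orbits = ε , neighbour ε 0F , neighbour ε 1F ,
          (λ ε∼n₀ → 0≢3 (≡.trans (≡.sym φ₀) (≡.trans (∼⇒φ≡ ε∼n₀) φ₃))) ,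
          (λ ε∼n₁ → 0≢1 (≡.trans (≡.sym φ₀) (≡.trans (∼⇒φ≡ ε∼n₁) φ₁))) ,
          (λ n₀∼n₁ → 3≢1 (≡.trans (≡.sym φ₃) (≡.trans (∼⇒φ≡ n₀∼n₁) φ₁)))
          where
          0≢3 : 0F ≢ 3F
          0≢3 ()
          0≢1 : 0F ≢ 1F
          0≢1 ()
          3≢1 : 3F ≢ 1F
          3≢1 ()

module SubgroupsOfPowers (T : Group 0ℓ 0ℓ) (T-simple : IsSimple T) (T-nonAbelian : IsNonAbelian T)
                         {n : ℕ} {L : (Fin n → Group.Carrier T) → Set}
                         (L≤Tⁿ : IsSubgroup (group (Fin n) T) L) where

  open Group T
  open GroupSolver T
  open GroupProperties T using (Central; simple∧nonAbelian⇒centreless; [_,_]; [,]-cong; [ε,_]; [_,ε]; [,]≈ε⇒central)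
  open IsSubgroup L≤Tⁿ renaming (resp to L-resp; ε∈ to L-ε; ∙∈ to L-∙; ⁻¹∈ to L-⁻¹)

  Projects : Fin n → Set
  Projects i = ∀ t → ∃ λ f → L f × f i ≈ t

  Determines : Fin n → Fin n → Set
  Determines i j = ∀ f → L f → f i ≈ ε → f j ≈ ε

  Independent : Fin n → Fin n → Set
  Independent i j = ∀ t → ∃ λ f → L f × f i ≈ ε × f j ≈ t

  determines-trans : ∀ {i j k} → Determines i j → Determines j k → Determines i k
  determines-trans i⇒j j⇒k f f∈L fi≈ε = j⇒k f f∈L (i⇒j f f∈L fi≈ε)

  private
    conj-ε : ∀ a → a ∙ ε ∙ a ⁻¹ ≈ ε
    conj-ε = solve 1 (λ a → a ⊕ id ⊕ ⊝ a ⊜ id) ≡.refl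

    conj-inv : ∀ a b → a ∙ (a ⁻¹ ∙ b ∙ a) ∙ a ⁻¹ ≈ b
    conj-inv = solve 2 (λ a b → a ⊕ (⊝ a ⊕ b ⊕ a) ⊕ ⊝ a ⊜ b) ≡.refl

    L-conj : ∀ {p f} → L p → L f → L (λ k → p k ∙ f k ∙ p k ⁻¹)
    L-conj p∈L f∈L = L-∙ (L-∙ p∈L f∈L) (L-⁻¹ p∈L)

  module _ {i : Fin n} (projects-i : Projects i) where

    private
      Vanishing : List (Fin n) → Carrier → Set
      Vanishing zs t = ∃ λ f → L f × f i ≈ t × All (λ j → f j ≈ ε) zs

      vanishing-normal : ∀ zs → IsNormalSubgroup T (Vanishing zs)
      vanishing-normal zs = record
        { isSubgroup = record
          { resp = λ { t≈t′ (f , f∈L , fi≈t , fzs≈ε) → f , f∈L , trans fi≈t t≈t′ , fzs≈ε }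
          ; ε∈  = (λ _ → ε) , L-ε , refl , All.universal (λ _ → refl) zs
          ; ∙∈  = λ { (f , f∈L , fi≈a , fzs≈ε) (f′ , f′∈L , f′i≈b , f′zs≈ε) →
                    _ , L-∙ f∈L f′∈L , ∙-cong fi≈a f′i≈b ,
                    All.zipWith (λ (p , q) → trans (∙-cong p q) (identityˡ ε)) (fzs≈ε , f′zs≈ε) }
          ; ⁻¹∈ = λ { (f , f∈L , fi≈a , fzs≈ε) → _ , L-⁻¹ f∈L , ⁻¹-cong fi≈a ,
                    All.map (λ p → trans (⁻¹-cong p) ε⁻¹≈ε) fzs≈ε }
          }
        ; conj = λ { s (f , f∈L , fi≈t , fzs≈ε) → let (p , p∈L , pi≈s) = projects-i s in
            _ , L-conj p∈L f∈L , ∙-cong (∙-cong pi≈s fi≈t) (⁻¹-cong pi≈s) ,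
            All.map (λ {k} fk≈ε → trans (∙-congʳ (∙-congˡ fk≈ε)) (conj-ε (p k))) fzs≈ε }
        }
        where open import Algebra.Properties.Group T using (ε⁻¹≈ε)

      centreless : ∀ a → Central a → a ≈ ε
      centreless = simple∧nonAbelian⇒centreless T-simple T-nonAbelian

    determines⊎independent : ∀ {j} → Determines j i ⊎ Independent j i
    determines⊎independent {j} with proj₂ T-simple (Vanishing (j ∷ [])) (vanishing-normal (j ∷ []))
    ... | inj₁ trivial = inj₁ λ f f∈L fj≈ε → trivial (f i) (f , f∈L , refl , fj≈ε ∷ [])
    ... | inj₂ all     = inj₂ λ t → let (f , f∈L , fi≈t , fj≈ε) = all t in f , f∈L , All.head fj≈ε , fi≈t

    -- if a occurs at i in an element vanishing on zs and b in one vanishing at j, their commutator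
    -- puts [ a , b ] at i and vanishes on j ∷ zs; T is centreless, so this normal subgroup is all of T
    separating : ∀ zs → All (λ j → Independent j i) zs → ∀ t → Vanishing zs t
    separating [] [] t = let (f , f∈L , fi≈t) = projects-i t in f , f∈L , fi≈t , []
    separating (j ∷ zs) (j-independent ∷ zs-independent)
      with proj₂ T-simple (Vanishing (j ∷ zs)) (vanishing-normal (j ∷ zs))
    ... | inj₂ all     = all
    ... | inj₁ trivial = ⊥-elim (proj₂ (proj₁ T-simple) (centreless _ ([,]≈ε⇒central λ b → trivial _ (commutator b))))
      where
      a = proj₁ (proj₁ T-simple)
      commutator : ∀ b → Vanishing (j ∷ zs) [ a , b ]
      commutator b with separating zs zs-independent a | j-independent b
      ... | f , f∈L , fi≈a , fzs≈ε | e , e∈L , ej≈ε , ei≈b =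
        (λ k → [ f k , e k ]) , L-∙ (L-∙ (L-∙ (L-⁻¹ f∈L) (L-⁻¹ e∈L)) f∈L) e∈L ,
        [,]-cong fi≈a ei≈b ,
        trans ([,]-cong refl ej≈ε) [ f j ,ε] ∷ All.map (λ fk≈ε → trans ([,]-cong fk≈ε refl) [ε, _ ]) fzs≈ε

    separating-all : ∀ {S : Fin n → Set} → Decidable S → (∀ j → S j → Independent j i) →
                     ∀ t → ∃ λ f → L f × f i ≈ t × ∀ j → S j → f j ≈ ε
    separating-all {S} S? S-independent t
      with separating (filter S? (allFin n)) (All.map (λ {j} → S-independent j) (all-filter S? (allFin n))) t
    ... | f , f∈L , fi≈t , vanishes = f , f∈L , fi≈t , λ j Sj → All.lookup vanishes (∈-filter⁺ S? (∈-allFin j) Sj)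

  Single : ∀ {d} → (Fin d → Fin n) → Fin d → Carrier → Set
  Single sel k a = ∃ λ f → L f × f (sel k) ≈ a × ∀ k′ → k′ ≢ k → f (sel k′) ≈ ε

  onto-from-singles : ∀ {d} (sel : Fin d → Fin n) → (∀ k a → Single sel k a) →
                      ∀ (t : Fin d → Carrier) → ∃ λ f → L f × ∀ k → f (sel k) ≈ t k
  onto-from-singles {zero}  sel single t = (λ _ → ε) , L-ε , λ ()
  onto-from-singles {suc d} sel single t = (λ i → s i ∙ f i) , L-∙ s∈L f∈L , f≈t′
    where
    restrict : ∀ {k a} → Single sel (suc k) a → Single (λ k → sel (suc k)) k a
    restrict (f , f∈L , fk≈a , vanishes) = f , f∈L , fk≈a , λ k′ k′≢k → vanishes (suc k′) (k′≢k ∘ suc-injective)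
    rest = onto-from-singles (λ k → sel (suc k)) (λ k a → restrict (single (suc k) a)) (λ k → t (suc k))
    f = proj₁ rest
    f∈L = proj₁ (proj₂ rest)
    f≈t = proj₂ (proj₂ rest)
    first = single zero (t zero ∙ f (sel zero) ⁻¹)
    s = proj₁ first
    s∈L = proj₁ (proj₂ first)
    f≈t′ : ∀ k → s (sel k) ∙ f (sel k) ≈ t k
    f≈t′ zero    = trans (∙-congʳ (proj₁ (proj₂ (proj₂ first))))
                         (solve 2 (λ a b → a ⊕ ⊝ b ⊕ b ⊜ a) ≡.refl (t zero) (f (sel zero)))
    f≈t′ (suc k) = trans (∙-cong (proj₂ (proj₂ (proj₂ first)) (suc k) λ ()) (f≈t k)) (identityˡ (t (suc k)))

  module _ (σ : Permutation′ n) (c : Fin n → Carrier)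
           (twist-closed : ∀ {f} → L f → L (λ i → c i ∙ f (σ ⟨$⟩ʳ i) ∙ c i ⁻¹)) where

    determines-image : ∀ {i j} → Determines i j → Determines (σ ⟨$⟩ʳ i) (σ ⟨$⟩ʳ j)
    determines-image {i} {j} i⇒j f f∈L fσi≈ε = begin
      f (σ ⟨$⟩ʳ j)                                   ≈⟨ solve 2 (λ c b → b ⊜ ⊝ c ⊕ (c ⊕ b ⊕ ⊝ c) ⊕ c) ≡.refl (c j) _ ⟩
      c j ⁻¹ ∙ (c j ∙ f (σ ⟨$⟩ʳ j) ∙ c j ⁻¹) ∙ c j    ≈⟨ ∙-congʳ (∙-congˡ (i⇒j _ (twist-closed f∈L) twisted-i≈ε)) ⟩
      c j ⁻¹ ∙ ε ∙ c j                               ≈⟨ solve 1 (λ c → ⊝ c ⊕ id ⊕ c ⊜ id) ≡.refl (c j) ⟩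
      ε                                              ∎
      where
      open import Relation.Binary.Reasoning.Setoid setoid
      twisted-i≈ε : c i ∙ f (σ ⟨$⟩ʳ i) ∙ c i ⁻¹ ≈ ε
      twisted-i≈ε = trans (∙-congʳ (∙-congˡ fσi≈ε)) (conj-ε (c i))

    independent-preimage : ∀ {i j} → Independent (σ ⟨$⟩ʳ i) (σ ⟨$⟩ʳ j) → Independent i j
    independent-preimage {i} {j} σi⊥σj a with σi⊥σj (c j ⁻¹ ∙ a ∙ c j)
    ... | f , f∈L , fσi≈ε , fσj≈ = _ , twist-closed f∈L ,
      trans (∙-congʳ (∙-congˡ fσi≈ε)) (conj-ε (c i)) , trans (∙-congʳ (∙-congˡ fσj≈)) (conj-inv (c j) a)

    projects-preimage : ∀ {i} → Projects (σ ⟨$⟩ʳ i) → Projects i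
    projects-preimage {i} projects-σi a with projects-σi (c i ⁻¹ ∙ a ∙ c i)
    ... | f , f∈L , fσi≈ = _ , twist-closed f∈L , trans (∙-congʳ (∙-congˡ fσi≈)) (conj-inv (c i) a)

  projection-isSubgroup : ∀ i → IsSubgroup T (λ t → ∃ λ f → L f × f i ≈ t)
  projection-isSubgroup i = record
    { resp = λ { t≈t′ (f , f∈L , fi≈t) → f , f∈L , trans fi≈t t≈t′ }
    ; ε∈  = (λ _ → ε) , L-ε , refl
    ; ∙∈  = λ { (f , f∈L , fi≈a) (f′ , f′∈L , f′i≈b) → _ , L-∙ f∈L f′∈L , ∙-cong fi≈a f′i≈b }
    ; ⁻¹∈ = λ { (f , f∈L , fi≈a) → _ , L-⁻¹ f∈L , ⁻¹-cong fi≈a }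
    }

module KernelM (T : Group 0ℓ 0ℓ) (x y : Group.Carrier T) where

  open Construction T x y
  open PermutationGroupK T x y
  open GroupY T x y
  open IsNormalSubgroup M-normal using () renaming (∙∈ to M-∙; ⁻¹∈ to M-⁻¹; conj to M-conj)

  coords-∙ : ∀ {a} b → M a → ∀ i → coords (a Y.∙ b) i T.≈ coords a i T.∙ coords b i
  coords-∙ b a∈M i = T.∙-congˡ (T.reflexive (≡.cong (coords b) (a∈M i)))

  coords-⁻¹ : ∀ {a} → M a → ∀ i → coords (a Y.⁻¹) i T.≈ coords a i T.⁻¹
  coords-⁻¹ {a} a∈M i =
    T.⁻¹-cong (T.reflexive (≡.cong (coords a) (≡.trans (≡.sym (a∈M _)) (Perm.inverseʳ (π a)))))

  coords-conj : ∀ z {m} → M m → ∀ i →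
                coords (z Y.∙ m Y.∙ z Y.⁻¹) i T.≈ coords z i T.∙ coords m (π z ⟨$⟩ʳ i) T.∙ coords z i T.⁻¹
  coords-conj z m∈M i = T.∙-congˡ (T.⁻¹-cong (T.reflexive (≡.cong (coords z)
    (≡.trans (≡.cong (π z ⟨$⟩ˡ_) (m∈M (π z ⟨$⟩ʳ i))) (Perm.inverseˡ (π z))))))

  -- M lies in the base group, so it is faithfully represented by its coordinates
  L : (Fin 6 → T.Carrier) → Set
  L f = ∃ λ m → M m × ∀ i → coords m i T.≈ f i

  L≤T⁶ : IsSubgroup (group (Fin 6) T) L
  L≤T⁶ = record
    { resp = λ { f≈f′ (m , m∈M , m≈f) → m , m∈M , λ i → T.trans (m≈f i) (f≈f′ i) }
    ; ε∈  = Y.ε , (λ _ → ≡.refl) , (λ _ → T.refl)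
    ; ∙∈  = λ { (m , m∈M , m≈f) (m′ , m′∈M , m′≈f′) → m Y.∙ m′ , M-∙ {m} {m′} m∈M m′∈M ,
              λ i → T.trans (coords-∙ {m} m′ m∈M i) (T.∙-cong (m≈f i) (m′≈f′ i)) }
    ; ⁻¹∈ = λ { (m , m∈M , m≈f) → m Y.⁻¹ , M-⁻¹ {m} m∈M ,
              λ i → T.trans (coords-⁻¹ {m} m∈M i) (T.⁻¹-cong (m≈f i)) }
    }

  L-twisted : ∀ z {f} → L f → L (λ i → coords z i T.∙ f (π z ⟨$⟩ʳ i) T.∙ coords z i T.⁻¹)
  L-twisted z (m , m∈M , m≈f) = z Y.∙ m Y.∙ z Y.⁻¹ , M-conj z {m} m∈M ,
    λ i → T.trans (coords-conj z {m} m∈M i) (T.∙-congʳ (T.∙-congˡ (m≈f (π z ⟨$⟩ʳ i))))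

  M-group : Group 0ℓ 0ℓ
  M-group = subgroupGroup Y M (IsNormalSubgroup.isSubgroup M-normal)

  M≅Tᵈ : ∀ {d} (sel : Fin d → Fin 6) →
         (∀ f → L f → (∀ k → f (sel k) T.≈ T.ε) → ∀ i → f i T.≈ T.ε) →
         (∀ (t : Fin d → T.Carrier) → ∃ λ f → L f × ∀ k → f (sel k) T.≈ t k) →
         M-group ≅ group (Fin d) T
  M≅Tᵈ {d} sel sel-faithful sel-onto = ι , isGroupIsomorphism M-group (group (Fin d) T) ι
    (λ a≈b k → proj₁ a≈b (sel k))
    (λ (a , a∈M) (b , b∈M) k → coords-∙ {a} b a∈M (sel k))
    (λ {a} {b} → injective {a} {b})
    (λ t → let (f , (m , m∈M , m≈f) , f≈t) = sel-onto t in (m , m∈M) , λ k → T.trans (m≈f (sel k)) (f≈t k))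
    where
    open import Algebra.Properties.Group T using (x∙y⁻¹≈ε⇒x≈y)
    ι : Group.Carrier M-group → Fin d → T.Carrier
    ι (m , _) k = coords m (sel k)
    injective : ∀ {a b} → (∀ k → ι a k T.≈ ι b k) → Group._≈_ M-group a b
    injective {a , a∈M} {b , b∈M} ιa≈ιb =
      (λ i → x∙y⁻¹≈ε⇒x≈y _ _ (T.trans (T.sym (ab⁻¹-coords i)) (sel-faithful _ ab⁻¹∈L
        (λ k → T.trans (ab⁻¹-coords (sel k)) (T.trans (T.∙-congʳ (ιa≈ιb k)) (T.inverseʳ _))) i))) ,
      (λ i → ≡.trans (a∈M i) (≡.sym (b∈M i)))
      where
      ab⁻¹-coords : ∀ i → coords (a Y.∙ b Y.⁻¹) i T.≈ coords a i T.∙ coords b i T.⁻¹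
      ab⁻¹-coords i = T.trans (coords-∙ {a} (b Y.⁻¹) a∈M i) (T.∙-congˡ (coords-⁻¹ {b} b∈M i))
      ab⁻¹∈L : L (coords (a Y.∙ b Y.⁻¹))
      ab⁻¹∈L = a Y.∙ b Y.⁻¹ , M-∙ {a} {b Y.⁻¹} a∈M (M-⁻¹ {b} b∈M) , λ _ → T.refl

  open GroupSolver T using (Expr; var; id; _⊕_; ⊝_; ⟦_⟧; prove)

  -- coordinates of the letters as words in x = var 0F and y = var 1F
  letterCoordinate : Letter → Fin 6 → Expr 2
  letterCoordinate H₁ _  = id
  letterCoordinate H₂ _  = id
  letterCoordinate Δ  0F = var 1F
  letterCoordinate Δ  1F = ⊝ var 1F
  letterCoordinate Δ  2F = var 1F
  letterCoordinate Δ  3F = ⊝ var 1F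
  letterCoordinate Δ  4F = var 0F
  letterCoordinate Δ  5F = var 0F

  wordCoordinate : Word → Fin 6 → Expr 2
  wordCoordinate []      _ = id
  wordCoordinate (ℓ ∷ w) i = letterCoordinate ℓ i ⊕ wordCoordinate w (⟦ ℓ ⟧₆ ⟨$⟩ʳ i)

  coords-eval : ∀ w i → coords (evalʸ w) i T.≈ ⟦ wordCoordinate w i ⟧ (x ∷ y ∷ [])
  coords-eval []       i = T.refl
  coords-eval (H₁ ∷ w) i = T.∙-congˡ (coords-eval w (h₁ ⟨$⟩ʳ i))
  coords-eval (H₂ ∷ w) i = T.∙-congˡ (coords-eval w (h₂ ⟨$⟩ʳ i))
  coords-eval (Δ  ∷ w) i = T.∙-cong (Δ-coordinate i) (coords-eval w (δ ⟨$⟩ʳ i))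
    where
    Δ-coordinate : ∀ i → f i T.≈ ⟦ letterCoordinate Δ i ⟧ (x ∷ y ∷ [])
    Δ-coordinate 0F = T.refl
    Δ-coordinate 1F = T.refl
    Δ-coordinate 2F = T.refl
    Δ-coordinate 3F = T.refl
    Δ-coordinate 4F = T.refl
    Δ-coordinate 5F = T.refl

  word-xy⁻² word-y⁻⁴ : Word
  word-xy⁻² = H₁ ∷ H₁ ∷ H₂ ∷ Δ ∷ H₁ ∷ H₁ ∷ Δ ∷ H₁ ∷ Δ ∷ []
  word-y⁻⁴  = H₁ ∷ Δ ∷ H₁ ∷ Δ ∷ H₁ ∷ Δ ∷ H₁ ∷ Δ ∷ []

  xy⁻²∈L₀ : ∃ λ f → L f × f 0F T.≈ x T.∙ y T.⁻¹ T.∙ y T.⁻¹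
  xy⁻²∈L₀ = coords (evalʸ word-xy⁻²) , (evalʸ word-xy⁻² , ∈M , λ _ → T.refl) ,
    T.trans (coords-eval word-xy⁻² 0F)
      (prove (wordCoordinate word-xy⁻² 0F) (var 0F ⊕ ⊝ var 1F ⊕ ⊝ var 1F) ≡.refl (x ∷ y ∷ []))
    where
    ∈M : M (evalʸ word-xy⁻²)
    ∈M i = ≡.trans (≡.cong (_⟨$⟩ʳ i) (π-eval word-xy⁻²)) (toWitness {a? = eval₆ word-xy⁻² ≈ₚ? Perm.id} tt i)

  y⁻⁴∈L₀ : ∃ λ f → L f × f 0F T.≈ y T.⁻¹ T.∙ y T.⁻¹ T.∙ y T.⁻¹ T.∙ y T.⁻¹
  y⁻⁴∈L₀ = coords (evalʸ word-y⁻⁴) , (evalʸ word-y⁻⁴ , ∈M , λ _ → T.refl) ,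
    T.trans (coords-eval word-y⁻⁴ 0F)
      (prove (wordCoordinate word-y⁻⁴ 0F) (⊝ var 1F ⊕ ⊝ var 1F ⊕ ⊝ var 1F ⊕ ⊝ var 1F) ≡.refl (x ∷ y ∷ []))
    where
    ∈M : M (evalʸ word-y⁻⁴)
    ∈M i = ≡.trans (≡.cong (_⟨$⟩ʳ i) (π-eval word-y⁻⁴)) (toWitness {a? = eval₆ word-y⁻⁴ ≈ₚ? Perm.id} tt i)

module KernelMIsPower (T : Group 0ℓ 0ℓ) (T-simple : IsSimple T) (T-nonAbelian : IsNonAbelian T)
                        (x y : Group.Carrier T)
                        (y-odd : ∃ λ p → Group._≈_ T (pow T y p) (Group.ε T) × ¬ (2 ∣ p))
                        (T=⟨x,y⟩ : ∀ t → ⟨ T ⟩ (x ∷ y ∷ []) t) where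

  open Construction T x y
  open PermutationGroupK T x y
  open GroupY T x y
  open KernelM T x y
  open SubgroupsOfPowers T T-simple T-nonAbelian L≤T⁶
  open GroupProperties T using (⟨⟩-minimal; odd-order⇒∈⟨square⟩; pow-ε)
  open GroupSolver T using (solve; _⊜_; _⊕_; ⊝_; id)

  projects-0 : Projects 0F
  projects-0 t = ⟨⟩-minimal P≤T (λ { (here ≡.refl) → x∈P ; (there (here ≡.refl)) → y∈P }) (T=⟨x,y⟩ t)
    where
    P≤T = projection-isSubgroup 0F
    open IsSubgroup P≤T renaming (resp to P-resp; ∙∈ to P-∙; ⁻¹∈ to P-⁻¹)
    p = proj₁ y-odd
    yᵖ≈ε = proj₁ (proj₂ y-odd)
    p-odd = proj₂ (proj₂ y-odd)
    y⁴∈P = P-resp (solve 1 (λ y → ⊝ (⊝ y ⊕ ⊝ y ⊕ ⊝ y ⊕ ⊝ y) ⊜ (y ⊕ (y ⊕ id)) ⊕ ((y ⊕ (y ⊕ id)) ⊕ id)) ≡.refl y)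
                  (P-⁻¹ y⁻⁴∈L₀)
    y∈P = odd-order⇒∈⟨square⟩ P≤T yᵖ≈ε p-odd (odd-order⇒∈⟨square⟩ P≤T (pow-ε {y} 2 {p} yᵖ≈ε) p-odd y⁴∈P)
    x∈P = P-resp (solve 2 (λ x y → x ⊕ ⊝ y ⊕ ⊝ y ⊕ (y ⊕ y) ⊜ x) ≡.refl x y) (P-∙ xy⁻²∈L₀ (P-∙ y∈P y∈P))

  carrier : Index → Y.Carrier
  carrier n = evalʸ (normalWord n)

  private
    carried-back : ∀ n k → k ≡ π (carrier n Y.⁻¹) ⟨$⟩ʳ (N₆ n ⟨$⟩ʳ k)
    carried-back n k = ≡.trans (≡.sym (Perm.inverseˡ (N₆ n)))
      (≡.cong (λ σ → σ ⟨$⟩ˡ (N₆ n ⟨$⟩ʳ k)) (≡.sym (π-eval (normalWord n))))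

  determines-carried : ∀ n {i j} → Determines i j → Determines (N₆ n ⟨$⟩ʳ i) (N₆ n ⟨$⟩ʳ j)
  determines-carried n {i} {j} i⇒j = ≡.subst (λ σ → Determines (σ ⟨$⟩ʳ i) (σ ⟨$⟩ʳ j)) (π-eval (normalWord n))
    (determines-image (π (carrier n)) (coords (carrier n)) (L-twisted (carrier n)) i⇒j)

  independent-carried : ∀ n {i j} → Independent i j → Independent (N₆ n ⟨$⟩ʳ i) (N₆ n ⟨$⟩ʳ j)
  independent-carried n {i} {j} i⊥j = independent-preimage (π z) (coords z) (L-twisted z)
    (≡.subst₂ Independent (carried-back n i) (carried-back n j) i⊥j)
    where z = carrier n Y.⁻¹

  projects-carried : ∀ n {i} → Projects i → Projects (N₆ n ⟨$⟩ʳ i)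
  projects-carried n {i} projects-i = projects-preimage (π z) (coords z) (L-twisted z)
    (≡.subst Projects (carried-back n i) projects-i)
    where z = carrier n Y.⁻¹

  projects : ∀ j → Projects j
  projects j = let (n , n0≡j , _) = moves-0,1 j in ≡.subst Projects n0≡j (projects-carried n projects-0)

  M≅T¹ : Determines 0F 2F → M-group ≅ group (Fin 1) T
  M≅T¹ d₀₂ = M≅Tᵈ (λ _ → 0F) (λ f f∈L f₀≈ε i → determines-0 i f f∈L (f₀≈ε 0F))
    λ t → let (f , f∈L , f₀≈t) = projects-0 (t 0F) in f , f∈L , λ { Fin.zero → f₀≈t ; (Fin.suc ()) }
    where
    apart : ∀ a b → blockOf a ≢ blockOf b → Determines a b
    apart a b a≁b = ≡.subst₂ Determines (proj₁ (moves-0,2 a b a≁b)) (proj₂ (moves-0,2 a b a≁b))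
      (determines-carried (locate₆ a b) d₀₂)
    determines-0 : ∀ j → Determines 0F j
    determines-0 0F = λ f f∈L f₀≈ε → f₀≈ε
    determines-0 1F = determines-trans (apart 0F 2F (λ ())) (apart 2F 1F (λ ()))
    determines-0 2F = apart 0F 2F (λ ())
    determines-0 3F = apart 0F 3F (λ ())
    determines-0 4F = apart 0F 4F (λ ())
    determines-0 5F = apart 0F 5F (λ ())

  independent-apart : Independent 0F 2F → ∀ a b → blockOf a ≢ blockOf b → Independent a b
  independent-apart i₀₂ a b a≁b = ≡.subst₂ Independent (proj₁ (moves-0,2 a b a≁b)) (proj₂ (moves-0,2 a b a≁b))
    (independent-carried (locate₆ a b) i₀₂)

  M≅T³ : Independent 0F 2F → Determines 0F 1F → M-group ≅ group (Fin 3) T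
  M≅T³ i₀₂ d₀₁ = M≅Tᵈ representative faithful (onto-from-singles representative single)
    where
    representative : Fin 3 → Fin 6
    representative 0F = 0F
    representative 1F = 2F
    representative 2F = 4F
    block-representative : ∀ k → blockOf (representative k) ≡ k
    block-representative 0F = ≡.refl
    block-representative 1F = ≡.refl
    block-representative 2F = ≡.refl
    determines-partner : ∀ a → Determines a (partner a)
    determines-partner a = let (n , n0≡a , n1≡a′) = moves-0,1 a in
      ≡.subst₂ Determines n0≡a n1≡a′ (determines-carried n d₀₁)
    faithful : ∀ f → L f → (∀ k → f (representative k) T.≈ T.ε) → ∀ i → f i T.≈ T.ε
    faithful f f∈L vanishes 0F = vanishes 0F
    faithful f f∈L vanishes 1F = determines-partner 0F f f∈L (vanishes 0F)
    faithful f f∈L vanishes 2F = vanishes 1F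
    faithful f f∈L vanishes 3F = determines-partner 2F f f∈L (vanishes 1F)
    faithful f f∈L vanishes 4F = vanishes 2F
    faithful f f∈L vanishes 5F = determines-partner 4F f f∈L (vanishes 2F)
    single : ∀ k a → Single representative k a
    single k a = let (f , f∈L , fk≈a , vanishes) = separated in
      f , f∈L , fk≈a ,
      λ k′ k′≢k → vanishes (representative k′) λ k′∈k → k′≢k (≡.trans (≡.sym (block-representative k′)) k′∈k)
      where
      separated : ∃ λ f → L f × f (representative k) T.≈ a × ∀ j → blockOf j ≢ k → f j T.≈ T.ε
      separated = separating-all (projects (representative k)) (λ j → ¬? (blockOf j ≟ k))
        (λ j j∉k → independent-apart i₀₂ j (representative k) λ j∈k → j∉k (≡.trans j∈k (block-representative k))) a


  M≅T⁶ : Independent 0F 2F → Independent 0F 1F → M-group ≅ group (Fin 6) T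
  M≅T⁶ i₀₂ i₀₁ = M≅Tᵈ (λ i → i) (λ f f∈L vanishes → vanishes) (onto-from-singles (λ i → i) single)
    where
    independent : ∀ a b → a ≢ b → Independent a b
    independent a b a≢b with blockOf a ≟ blockOf b
    ... | no a≁b  = independent-apart i₀₂ a b a≁b
    ... | yes a∼b = let (n , n0≡a , n1≡a′) = moves-0,1 a in
      ≡.subst₂ Independent n0≡a (≡.trans n1≡a′ (≡.sym (same-block⇒partner a b a≢b a∼b))) (independent-carried n i₀₁)
    single : ∀ k a → Single (λ i → i) k a
    single k a = separating-all (projects k) (λ j → ¬? (j ≟ k)) (λ j j≢k → independent j k j≢k) a

  M≅Tᵈ-for-d∈1,3,6 : ∃ λ d → (d ≡ 1 ⊎ d ≡ 3 ⊎ d ≡ 6) × (M-group ≅ group (Fin d) T)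
  M≅Tᵈ-for-d∈1,3,6 = by-cases (determines⊎independent (projects 2F)) (determines⊎independent (projects 1F))
    where
    by-cases : Determines 0F 2F ⊎ Independent 0F 2F → Determines 0F 1F ⊎ Independent 0F 1F →
               ∃ λ d → (d ≡ 1 ⊎ d ≡ 3 ⊎ d ≡ 6) × (M-group ≅ group (Fin d) T)
    by-cases (inj₁ d₀₂) _          = 1 , inj₁ ≡.refl , M≅T¹ d₀₂
    by-cases (inj₂ i₀₂) (inj₁ d₀₁) = 3 , inj₂ (inj₁ ≡.refl) , M≅T³ i₀₂ d₀₁
    by-cases (inj₂ i₀₂) (inj₂ i₀₁) = 6 , inj₂ (inj₂ ≡.refl) , M≅T⁶ i₀₂ i₀₁

corollary1p2 :
    (T : Group 0ℓ 0ℓ) → IsFinite T → IsNonAbelian T → IsSimple T →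
    (x y : Group.Carrier T) →
    HasOrder T x 2 →
    (∃ λ p → HasOrder T y p × Prime p × ¬ (2 ∣ p)) →
    (∀ t → ⟨ T ⟩ (x ∷ y ∷ []) t) →
    let open Construction T x y in
      IsUndirected Γ
    × Connected Γ
    × TwoArcTransitive Γ act
    × ∃ λ (d : ℕ) → (d ≡ 1 ⊎ d ≡ 3 ⊎ d ≡ 6)
      × Σ (Group.Carrier Y → Set) λ M → Σ (IsNormalSubgroup Y M) λ nM →
          (subgroupGroup Y M (IsNormalSubgroup.isSubgroup nM) ≅ group (Fin d) T)
        × (quotientGroup Y M nM ≅ Sym 4)
        × IsNCover Γ act M
        × (normalQuotient Γ act M ≅ᴳ K4)
corollary1p2 T _ T-nonAbelian T-simple x y (_ , x²≈ε , _) (p , (_ , yᵖ≈ε , y-order) , p-prime , p-odd) T=⟨x,y⟩ =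
  let (d , d∈1,3,6 , M≅Tᵈ) = M≅Tᵈ-for-d∈1,3,6 in
    ((λ u v → Adj-sym g²≈ε {u} {v}) , Adj-irrefl (g∉H y≉ε))
  , all-reachable⇒connected g²≈ε
      (GroupProperties.generated-induction X (Reachable g²≈ε) (reachable-isSubgroup g²≈ε) generators-reachable)
  , twoArcTransitive g²≈ε
  , d , d∈1,3,6 , M , M-normal , M≅Tᵈ , Y/M≅S₄ , isNCover , ΓN≅K₄
  where
  open Construction T x y using (X; Y; gᵧ)
  open GroupY T x y
  open CosetGraphs.OnFourPoints Y H-isSubgroup gᵧ ⟦ H₁ ⟧ʸ ⟦ H₂ ⟧ʸ h₁∈H h₂∈H
    (λ {h} → H-elements {h}) g∙h₂≈h₂∙g h₁²∙h₂≈h₂∙h₁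
  open FourPointLabelling ψʸ (λ {a} {b} → ψʸ-cong {a} {b}) ψʸ-homo M-normal M⇔ψʸ≈id
    (ψʸ-letter H₁ 0F) (ψʸ-letter H₂ 0F) ψʸ-fixes-0⇒stabiliser (ψʸ-letter Δ 0F) (ψʸ-letter H₁ 3F) (ψʸ-letter H₁ 1F)
  open KernelMIsPower T T-simple T-nonAbelian x y (p , yᵖ≈ε , p-odd) T=⟨x,y⟩
  g²≈ε : gᵧ Y.∙ gᵧ Y.≈ Y.ε
  g²≈ε = g-involution (T.trans (T.∙-congˡ (T.sym (T.identityʳ x))) x²≈ε)
  y≉ε : ¬ y T.≈ T.ε
  y≉ε y≈ε = y-order 1 (s≤s z≤n) (nonTrivial⇒n>1 p {{prime⇒nonTrivial p-prime}}) (T.trans (T.identityʳ y) y≈ε)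
  generators-reachable : ∀ {γ} (γ∈ : γ ∈ _) → Reachable g²≈ε (γ , gen γ∈)
  generators-reachable (here ≡.refl)                 = H-reachable g²≈ε h₁∈H
  generators-reachable (there (here ≡.refl))         = H-reachable g²≈ε h₂∈H
  generators-reachable (there (there (here ≡.refl))) = g-reachable g²≈ε
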